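{- For every set $\mathcal{B}$, the category $\mathcal{B}$-$\mathbf{Scwf}^{\Rightarrow}$ has an initial object.
   Context: A simply typed cwf (scwf) consists of a category $\mathcal{C}$ with a chosen terminal object $1$; a set $\mathrm{Ty}$; for each $A\in\mathrm{Ty}$ a presheaf $\mathrm{Tm}(-,A)$ on $\mathcal{C}$ (action written $a[\gamma]$); and for each $\Gamma$, $A$ a chosen $\Gamma\cdot A$, $\mathrm{p}_{\Gamma,A}:\Gamma\cdot A\to\Gamma$, $\mathrm{q}_{\Gamma,A}\in\mathrm{Tm}(\Gamma\cdot A,A)$ such that for all $\gamma:\Delta\to\Gamma$, $a\in\mathrm{Tm}(\Delta,A)$ there is a unique $\langle\gamma,a\rangle:\Delta\to\Gamma\cdot A$ with $\mathrm{p}\circ\langle\gamma,a\rangle=\gamma$, $\mathrm{q}[\langle\gamma,a\rangle]=a$. A strict scwf-morphism is a functor $F$ preserving $1$ on the nose, a function $F$ on types and natural transformations $\mathrm{Tm}(-,A)\Rightarrow\mathrm{Tm}'(F-,FA)$ with $F(\Gamma\cdot A)=F\Gamma\cdot FA$, $F(\mathrm{p})=\mathrm{p}$, $F(\mathrm{q})=\mathrm{q}$. A $\Rightarrow$-structure on an scwf consists of types $A\Rightarrow B$ for $A,B\in\mathrm{Ty}$ and operations $\lambda_{\Gamma,A,B}:\mathrm{Tm}(\Gamma\cdot A,B)\to\mathrm{Tm}(\Gamma,A\Rightarrow B)$ and $\mathrm{ap}_{\Gamma,A,B}:\mathrm{Tm}(\Gamma,A\Rightarrow B)\times\mathrm{Tm}(\Gamma,A)\to\mathrm{Tm}(\Gamma,B)$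 such that for $a\in\mathrm{Tm}(\Gamma,A)$, $b\in\mathrm{Tm}(\Gamma\cdot A,B)$, $c\in\mathrm{Tm}(\Gamma,A\Rightarrow B)$, $\gamma:\Delta\to\Gamma$: $\lambda(b)[\gamma]=\lambda(b[\langle\gamma\circ\mathrm{p}_{\Delta,A},\mathrm{q}_{\Delta,A}\rangle])$, $\mathrm{ap}(c,a)[\gamma]=\mathrm{ap}(c[\gamma],a[\gamma])$, $\mathrm{ap}(\lambda(b),a)=b[\langle\mathrm{id}_\Gamma,a\rangle]$, $\lambda(\mathrm{ap}(c[\mathrm{p}_{\Gamma,A}],\mathrm{q}_{\Gamma,A}))=c$. A strict morphism preserves it if $F(A\Rightarrow B)=FA\Rightarrow FB$ and $F(\mathrm{ap}(c,a))=\mathrm{ap}(Fc,Fa)$. For a set $\mathcal{B}$, $\mathcal{B}$-$\mathbf{Scwf}^{\Rightarrow}$ is the category whose objects are small scwfs with $\Rightarrow$-structure together with a function $[\![-]\!]:\mathcal{B}\to\mathrm{Ty}$, and whose morphisms are strict scwf-morphisms preserving the $\Rightarrow$-structure and commuting with these functions. -}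

module Defs where

open import Level using (Level)
open import Data.Product using (Σ; _,_)
open import Relation.Binary.PropositionalEquality
  using (_≡_; refl; subst; subst₂)

record Scwf : Set₁ where
  infixr 9 _∘_
  infixl 8 _[_]
  infixl 5 _·_
  field
    Ctx   : Set
    Hom   : Ctx → Ctx → Set          -- Hom Δ Γ  =  C(Δ , Γ)
    id    : ∀ {Γ} → Hom Γ Γ
    _∘_   : ∀ {Γ Δ Θ} → Hom Δ Γ → Hom Θ Δ → Hom Θ Γ
    idˡ   : ∀ {Δ Γ} (γ : Hom Δ Γ) → id ∘ γ ≡ γ
    idʳ   : ∀ {Δ Γ} (γ : Hom Δ Γ) → γ ∘ id ≡ γ
    assoc : ∀ {Γ Δ Θ Ξ} (γ : Hom Δ Γ) (δ : Hom Θ Δ) (θ : Hom Ξ Θ)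
            → (γ ∘ δ) ∘ θ ≡ γ ∘ (δ ∘ θ)
    ⋄        : Ctx
    !        : ∀ {Γ} → Hom Γ ⋄
    !-unique : ∀ {Γ} (f : Hom Γ ⋄) → f ≡ !
    Ty    : Set
    Tm    : Ctx → Ty → Set
    _[_]  : ∀ {Γ Δ A} → Tm Γ A → Hom Δ Γ → Tm Δ A
    [id]  : ∀ {Γ A} (a : Tm Γ A) → a [ id ] ≡ a
    [∘]   : ∀ {Γ Δ Θ A} (a : Tm Γ A) (γ : Hom Δ Γ) (δ : Hom Θ Δ)
            → a [ γ ∘ δ ] ≡ a [ γ ] [ δ ]
    _·_   : Ctx → Ty → Ctx
    p     : ∀ {Γ A} → Hom (Γ · A) Γ
    q     : ∀ {Γ A} → Tm (Γ · A) A
    ⟨_,_⟩ : ∀ {Δ Γ A} → Hom Δ Γ → Tm Δ A → Hom Δ (Γ · A)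
    p∘⟨⟩  : ∀ {Δ Γ A} (γ : Hom Δ Γ) (a : Tm Δ A) → p ∘ ⟨ γ , a ⟩ ≡ γ
    q[⟨⟩] : ∀ {Δ Γ A} (γ : Hom Δ Γ) (a : Tm Δ A) → q [ ⟨ γ , a ⟩ ] ≡ a
    ⟨⟩-unique : ∀ {Δ Γ A} (γ : Hom Δ Γ) (a : Tm Δ A) (δ : Hom Δ (Γ · A))
                → p ∘ δ ≡ γ → q [ δ ] ≡ a → δ ≡ ⟨ γ , a ⟩

record ArrowStr (S : Scwf) : Set where
  open Scwf S
  infixr 6 _⇒_
  field
    _⇒_  : Ty → Ty → Ty
    lam  : ∀ {Γ A B} → Tm (Γ · A) B → Tm Γ (A ⇒ B)
    ap   : ∀ {Γ A B} → Tm Γ (A ⇒ B) → Tm Γ A → Tm Γ B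
    lam[] : ∀ {Δ Γ A B} (b : Tm (Γ · A) B) (γ : Hom Δ Γ)
            → lam b [ γ ] ≡ lam (b [ ⟨ γ ∘ p {Δ} {A} , q {Δ} {A} ⟩ ])
    ap[]  : ∀ {Δ Γ A B} (c : Tm Γ (A ⇒ B)) (a : Tm Γ A) (γ : Hom Δ Γ)
            → ap c a [ γ ] ≡ ap (c [ γ ]) (a [ γ ])
    β     : ∀ {Γ A B} (b : Tm (Γ · A) B) (a : Tm Γ A)
            → ap (lam b) a ≡ b [ ⟨ id , a ⟩ ]
    η     : ∀ {Γ A B} (c : Tm Γ (A ⇒ B))
            → lam (ap (c [ p {Γ} {A} ]) (q {Γ} {A})) ≡ c

record BScwf (𝓑 : Set) : Set₁ where
  field
    scwf  : Scwf
    arr   : ArrowStr scwf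
    ⟦_⟧   : 𝓑 → Scwf.Ty scwf

record BScwfMor {𝓑 : Set} (X Y : BScwf 𝓑) : Set where
  private
    module S = Scwf (BScwf.scwf X)
    module T = Scwf (BScwf.scwf Y)
    module SA = ArrowStr (BScwf.arr X)
    module TA = ArrowStr (BScwf.arr Y)
  field
    F₀    : S.Ctx → T.Ctx
    F₁    : ∀ {Δ Γ} → S.Hom Δ Γ → T.Hom (F₀ Δ) (F₀ Γ)
    F-id  : ∀ {Γ} → F₁ (S.id {Γ}) ≡ T.id
    F-∘   : ∀ {Γ Δ Θ} (γ : S.Hom Δ Γ) (δ : S.Hom Θ Δ)
            → F₁ (γ S.∘ δ) ≡ F₁ γ T.∘ F₁ δ
    F-⋄   : F₀ S.⋄ ≡ T.⋄
    FTy   : S.Ty → T.Ty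
    FTm   : ∀ {Γ A} → S.Tm Γ A → T.Tm (F₀ Γ) (FTy A)
    FTm-nat : ∀ {Δ Γ A} (a : S.Tm Γ A) (γ : S.Hom Δ Γ)
            → FTm (a S.[ γ ]) ≡ FTm a T.[ F₁ γ ]
    F-·   : ∀ Γ A → F₀ (Γ S.· A) ≡ F₀ Γ T.· FTy A
    F-p   : ∀ {Γ A} → subst (λ Z → T.Hom Z (F₀ Γ)) (F-· Γ A) (F₁ (S.p {Γ} {A}))
                      ≡ T.p
    F-q   : ∀ {Γ A} → subst (λ Z → T.Tm Z (FTy A)) (F-· Γ A) (FTm (S.q {Γ} {A}))
                      ≡ T.q
    F-⇒   : ∀ A B → FTy (A SA.⇒ B) ≡ FTy A TA.⇒ FTy B
    F-ap  : ∀ {Γ A B} (c : S.Tm Γ (A SA.⇒ B)) (a : S.Tm Γ A)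
            → FTm (SA.ap c a) ≡ TA.ap (subst (T.Tm (F₀ Γ)) (F-⇒ A B) (FTm c)) (FTm a)
    F-⟦⟧  : ∀ b → FTy (BScwf.⟦_⟧ X b) ≡ BScwf.⟦_⟧ Y b

-- Equality of morphisms: the underlying data agree (the remaining
-- fields are equations, i.e. propositions).
record _≈ᴹ_ {𝓑 : Set} {X Y : BScwf 𝓑} (F G : BScwfMor X Y) : Set where
  private
    module S = Scwf (BScwf.scwf X)
    module T = Scwf (BScwf.scwf Y)
    module F = BScwfMor F
    module G = BScwfMor G
  field
    eq₀  : ∀ Γ → F.F₀ Γ ≡ G.F₀ Γ
    eq₁  : ∀ {Δ Γ} (γ : S.Hom Δ Γ)
           → subst₂ T.Hom (eq₀ Δ) (eq₀ Γ) (F.F₁ γ) ≡ G.F₁ γ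
    eqTy : ∀ A → F.FTy A ≡ G.FTy A
    eqTm : ∀ {Γ A} (a : S.Tm Γ A)
           → subst₂ T.Tm (eq₀ Γ) (eqTy A) (F.FTm a) ≡ G.FTm a

IsInitial : {𝓑 : Set} → BScwf 𝓑 → Set₁
IsInitial {𝓑} O = (X : BScwf 𝓑) → Σ (BScwfMor O X) (λ f → (g : BScwfMor O X) → g ≈ᴹ f)

HasInitial : (𝓑 : Set) → Set₁
HasInitial 𝓑 = Σ (BScwf 𝓑) IsInitial

-- The initial object is the term model of β-normal η-long forms over the base
-- types 𝓑: substitution is computed by hereditary substitution, so all scwf and
-- ⇒-equations hold on the nose (η because terms are η-long, β because
-- application is hereditary).  A normal form is interpreted in any X by
-- structural recursion, and this is a strict morphism because hereditary
-- substitution and application are sound for the ⇒-structure of X.  It is the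
-- only one: a morphism is forced on types and contexts by strict preservation,
-- on variables by p and q, on neutral terms by ap, and on λ-abstractions by η.
module Submission where

open import Defs
open import Data.Product using (_,_)
open import Data.Sum using (_⊎_; inj₁; inj₂)
open import Data.Unit using (⊤; tt)
open import Relation.Binary.PropositionalEquality
  using (_≡_; refl; sym; trans; cong; cong₂; subst; subst₂; module ≡-Reasoning)
open ≡-Reasoning

module ScwfProperties (S : Scwf) where
  open Scwf S

  ⟨,⟩-∘ : ∀ {Θ Δ Γ A} (γ : Hom Δ Γ) (a : Tm Δ A) (δ : Hom Θ Δ)
        → ⟨ γ , a ⟩ ∘ δ ≡ ⟨ γ ∘ δ , a [ δ ] ⟩
  ⟨,⟩-∘ γ a δ = ⟨⟩-unique _ _ _ (trans (sym (assoc _ _ _)) (cong (_∘ δ) (p∘⟨⟩ γ a)))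
                                (trans ([∘] _ _ _) (cong (_[ δ ]) (q[⟨⟩] γ a)))

  subst₂-[] : ∀ {Δ₀ Δ Γ₀ Γ A₀ A} (eΔ : Δ₀ ≡ Δ) (eΓ : Γ₀ ≡ Γ) (eA : A₀ ≡ A)
              (a : Tm Γ₀ A₀) (γ : Hom Δ₀ Γ₀) {l : Tm Δ₀ A₀}
            → l ≡ a [ γ ] → subst₂ Tm eΔ eA l ≡ subst₂ Tm eΓ eA a [ subst₂ Hom eΔ eΓ γ ]
  subst₂-[] refl refl refl a γ e = e

  subst₂-∘ : ∀ {Γ₀ Γ Δ₀ Δ Θ₀ Θ} (eΓ : Γ₀ ≡ Γ) (eΔ : Δ₀ ≡ Δ) (eΘ : Θ₀ ≡ Θ)
             (γ : Hom Δ₀ Γ₀) (δ : Hom Θ₀ Δ₀) {l : Hom Θ₀ Γ₀}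
           → l ≡ γ ∘ δ → subst₂ Hom eΘ eΓ l ≡ subst₂ Hom eΔ eΓ γ ∘ subst₂ Hom eΘ eΔ δ
  subst₂-∘ refl refl refl γ δ e = e

  subst₂-p : ∀ {Z Γ₀ Γ A₀ A} (e : Z ≡ Γ₀ · A₀) (eΓ : Γ₀ ≡ Γ) (eA : A₀ ≡ A) (h : Hom Z Γ₀)
           → subst (λ Z → Hom Z Γ₀) e h ≡ p
           → subst₂ Hom (trans e (cong₂ _·_ eΓ eA)) eΓ h ≡ p
  subst₂-p refl refl refl h e = e

  subst₂-q : ∀ {Z Γ₀ Γ A₀ A} (e : Z ≡ Γ₀ · A₀) (eΓ : Γ₀ ≡ Γ) (eA : A₀ ≡ A) (h : Tm Z A₀)
           → subst (λ Z → Tm Z A₀) e h ≡ q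
           → subst₂ Tm (trans e (cong₂ _·_ eΓ eA)) eA h ≡ q
  subst₂-q refl refl refl h e = e

  module _ (arr : ArrowStr S) where
    open ArrowStr arr

    subst₂-ap : ∀ {G₀ G A₀ A B₀ B F} (eG : G₀ ≡ G) (eA : A₀ ≡ A) (eB : B₀ ≡ B) (e⇒ : F ≡ A₀ ⇒ B₀)
                (c : Tm G₀ F) (a : Tm G₀ A₀) {l : Tm G₀ B₀}
              → l ≡ ap (subst (Tm G₀) e⇒ c) a
              → subst₂ Tm eG eB l
              ≡ ap (subst₂ Tm eG (trans e⇒ (cong₂ _⇒_ eA eB)) c) (subst₂ Tm eG eA a)
    subst₂-ap refl refl refl refl c a e = e

module NormalForms (𝓑 : Set) where

  infixr 6 _⇒_
  data Ty : Set where
    ι   : 𝓑 → Ty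
    _⇒_ : Ty → Ty → Ty

  infixl 5 _▷_
  data Con : Set where
    ε   : Con
    _▷_ : Con → Ty → Con

  data Var : Con → Ty → Set where
    vz : ∀ {Γ A} → Var (Γ ▷ A) A
    vs : ∀ {Γ A B} → Var Γ A → Var (Γ ▷ B) A

  -- β-normal η-long forms; a spine Sp Γ A C takes a head of type A to type C.
  infixr 5 _∷_
  mutual
    data Nf (Γ : Con) : Ty → Set where
      lam : ∀ {A B} → Nf (Γ ▷ A) B → Nf Γ (A ⇒ B)
      ne  : ∀ {A b} → Var Γ A → Sp Γ A (ι b) → Nf Γ (ι b)

    data Sp (Γ : Con) : Ty → Ty → Set where
      []  : ∀ {C} → Sp Γ C C
      _∷_ : ∀ {A B C} → Nf Γ A → Sp Γ B C → Sp Γ (A ⇒ B) C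

  infixr 5 _++_
  _++_ : ∀ {Γ A B C} → Sp Γ A B → Sp Γ B C → Sp Γ A C
  [] ++ s = s
  (n ∷ s) ++ s' = n ∷ (s ++ s')

  ++-identityʳ : ∀ {Γ A B} (s : Sp Γ A B) → s ++ [] ≡ s
  ++-identityʳ [] = refl
  ++-identityʳ (n ∷ s) = cong (n ∷_) (++-identityʳ s)

  ++-assoc : ∀ {Γ A B C D} (s : Sp Γ A B) (s' : Sp Γ B C) (s'' : Sp Γ C D)
           → (s ++ s') ++ s'' ≡ s ++ (s' ++ s'')
  ++-assoc [] s' s'' = refl
  ++-assoc (n ∷ s) s' s'' = cong (n ∷_) (++-assoc s s' s'')

module Renaming (𝓑 : Set) where
  open NormalForms 𝓑

  Ren : Con → Con → Set
  Ren Δ Γ = ∀ {A} → Var Γ A → Var Δ A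

  wk : ∀ {Γ B} → Ren (Γ ▷ B) Γ
  wk = vs

  liftRen : ∀ {Δ Γ A} → Ren Δ Γ → Ren (Δ ▷ A) (Γ ▷ A)
  liftRen ρ vz = vz
  liftRen ρ (vs x) = vs (ρ x)

  mutual
    ren : ∀ {Δ Γ A} → Ren Δ Γ → Nf Γ A → Nf Δ A
    ren ρ (lam t) = lam (ren (liftRen ρ) t)
    ren ρ (ne x sp) = ne (ρ x) (renSp ρ sp)

    renSp : ∀ {Δ Γ A C} → Ren Δ Γ → Sp Γ A C → Sp Δ A C
    renSp ρ [] = []
    renSp ρ (t ∷ sp) = ren ρ t ∷ renSp ρ sp

  liftRen-cong : ∀ {Δ Γ A} {ρ ρ' : Ren Δ Γ} → (∀ {C} (x : Var Γ C) → ρ x ≡ ρ' x)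
               → ∀ {C} (x : Var (Γ ▷ A) C) → liftRen ρ x ≡ liftRen ρ' x
  liftRen-cong h vz = refl
  liftRen-cong h (vs x) = cong vs (h x)

  mutual
    ren-cong : ∀ {Δ Γ A} {ρ ρ' : Ren Δ Γ} → (∀ {C} (x : Var Γ C) → ρ x ≡ ρ' x)
             → (t : Nf Γ A) → ren ρ t ≡ ren ρ' t
    ren-cong h (lam t) = cong lam (ren-cong (liftRen-cong h) t)
    ren-cong h (ne x sp) = cong₂ ne (h x) (renSp-cong h sp)

    renSp-cong : ∀ {Δ Γ A C} {ρ ρ' : Ren Δ Γ} → (∀ {C} (x : Var Γ C) → ρ x ≡ ρ' x)
               → (s : Sp Γ A C) → renSp ρ s ≡ renSp ρ' s
    renSp-cong h [] = refl
    renSp-cong h (t ∷ s) = cong₂ _∷_ (ren-cong h t) (renSp-cong h s)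

  mutual
    ren-∘ : ∀ {Θ Δ Γ A} (ρ : Ren Θ Δ) (ρ' : Ren Δ Γ) (t : Nf Γ A)
          → ren ρ (ren ρ' t) ≡ ren (λ x → ρ (ρ' x)) t
    ren-∘ ρ ρ' (lam t) = cong lam (trans (ren-∘ (liftRen ρ) (liftRen ρ') t)
                                         (ren-cong (λ { vz → refl ; (vs x) → refl }) t))
    ren-∘ ρ ρ' (ne x sp) = cong (ne (ρ (ρ' x))) (renSp-∘ ρ ρ' sp)

    renSp-∘ : ∀ {Θ Δ Γ A C} (ρ : Ren Θ Δ) (ρ' : Ren Δ Γ) (s : Sp Γ A C)
            → renSp ρ (renSp ρ' s) ≡ renSp (λ x → ρ (ρ' x)) s
    renSp-∘ ρ ρ' [] = refl
    renSp-∘ ρ ρ' (t ∷ s) = cong₂ _∷_ (ren-∘ ρ ρ' t) (renSp-∘ ρ ρ' s)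

  mutual
    ren-id : ∀ {Γ A} (t : Nf Γ A) → ren (λ x → x) t ≡ t
    ren-id (lam t) = cong lam (trans (ren-cong (λ { vz → refl ; (vs x) → refl }) t) (ren-id t))
    ren-id (ne x sp) = cong (ne x) (renSp-id sp)

    renSp-id : ∀ {Γ A C} (s : Sp Γ A C) → renSp (λ x → x) s ≡ s
    renSp-id [] = refl
    renSp-id (t ∷ s) = cong₂ _∷_ (ren-id t) (renSp-id s)

  renSp-++ : ∀ {Δ Γ A B C} (ρ : Ren Δ Γ) (s : Sp Γ A B) (s' : Sp Γ B C)
           → renSp ρ (s ++ s') ≡ renSp ρ s ++ renSp ρ s'
  renSp-++ ρ [] s' = refl
  renSp-++ ρ (t ∷ s) s' = cong (ren ρ t ∷_) (renSp-++ ρ s s')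

  ren-wk-liftRen : ∀ {Δ Γ A B} (ρ : Ren Δ Γ) (n : Nf Γ A)
                 → ren (wk {B = B}) (ren ρ n) ≡ ren (liftRen ρ) (ren wk n)
  ren-wk-liftRen ρ n = trans (ren-∘ wk ρ n) (sym (ren-∘ (liftRen ρ) wk n))

  renSp-wk-liftRen : ∀ {Δ Γ A C B} (ρ : Ren Δ Γ) (s : Sp Γ A C)
                   → renSp (wk {B = B}) (renSp ρ s) ≡ renSp (liftRen ρ) (renSp wk s)
  renSp-wk-liftRen ρ s = trans (renSp-∘ wk ρ s) (sym (renSp-∘ (liftRen ρ) wk s))

module HereditarySubstitution (𝓑 : Set) where
  open NormalForms 𝓑
  open Renaming 𝓑

  -- A substitution replacing variables by normal forms of the single type A:
  -- hereditary application then recurses on A, which makes it terminate.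
  data Ent (A : Ty) (Δ : Con) : Ty → Set where
    var : ∀ {C} → Var Δ C → Ent A Δ C
    nf  : Nf Δ A → Ent A Δ A

  HSub : Ty → Con → Con → Set
  HSub A Δ Γ = ∀ {C} → Var Γ C → Ent A Δ C

  renEnt : ∀ {A Δ Γ C} → Ren Δ Γ → Ent A Γ C → Ent A Δ C
  renEnt ρ (var y) = var (ρ y)
  renEnt ρ (nf n) = nf (ren ρ n)

  liftH : ∀ {A Δ Γ B} → HSub A Δ Γ → HSub A (Δ ▷ B) (Γ ▷ B)
  liftH σ vz = var vz
  liftH σ (vs x) = renEnt wk (σ x)

  single : ∀ {A Δ} → Nf Δ A → HSub A Δ (Δ ▷ A)
  single m vz = nf m
  single m (vs x) = var x

  mutual
    hsub : ∀ {Γ Δ B} (A : Ty) → Nf Γ B → HSub A Δ Γ → Nf Δ B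
    hsub A (lam u) σ = lam (hsub A u (liftH σ))
    hsub A (ne x sp) σ = appEnt A (σ x) (hsubSp A sp σ)

    hsubSp : ∀ {Γ Δ B C} (A : Ty) → Sp Γ B C → HSub A Δ Γ → Sp Δ B C
    hsubSp A [] σ = []
    hsubSp A (n ∷ sp) σ = hsub A n σ ∷ hsubSp A sp σ

    appEnt : ∀ {Δ C b} (A : Ty) → Ent A Δ C → Sp Δ C (ι b) → Nf Δ (ι b)
    appEnt A (var y) sp = ne y sp
    appEnt A (nf n) sp = app A n sp

    app : ∀ {Δ C} (A : Ty) → Nf Δ A → Sp Δ A C → Nf Δ C
    app A n [] = n
    app (A ⇒ B) (lam u) (m ∷ sp) = app B (hsub A u (single m)) sp

  mutual
    hsub-cong : ∀ {Γ Δ B} (A : Ty) (u : Nf Γ B) {σ σ' : HSub A Δ Γ}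
              → (∀ {C} (x : Var Γ C) → σ x ≡ σ' x) → hsub A u σ ≡ hsub A u σ'
    hsub-cong A (lam u) h = cong lam (hsub-cong A u λ { vz → refl ; (vs x) → cong (renEnt wk) (h x) })
    hsub-cong A (ne x sp) h = cong₂ (appEnt A) (h x) (hsubSp-cong A sp h)

    hsubSp-cong : ∀ {Γ Δ B C} (A : Ty) (s : Sp Γ B C) {σ σ' : HSub A Δ Γ}
                → (∀ {C} (x : Var Γ C) → σ x ≡ σ' x) → hsubSp A s σ ≡ hsubSp A s σ'
    hsubSp-cong A [] h = refl
    hsubSp-cong A (n ∷ s) h = cong₂ _∷_ (hsub-cong A n h) (hsubSp-cong A s h)

  mutual
    hsub-ren : ∀ {Γ Γ' Δ B} (A : Ty) (ρ : Ren Γ' Γ) (u : Nf Γ B) (σ : HSub A Δ Γ')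
             → hsub A (ren ρ u) σ ≡ hsub A u (λ x → σ (ρ x))
    hsub-ren A ρ (lam u) σ = cong lam (trans (hsub-ren A (liftRen ρ) u (liftH σ))
                                             (hsub-cong A u λ { vz → refl ; (vs x) → refl }))
    hsub-ren A ρ (ne x sp) σ = cong (appEnt A (σ (ρ x))) (hsubSp-ren A ρ sp σ)

    hsubSp-ren : ∀ {Γ Γ' Δ B C} (A : Ty) (ρ : Ren Γ' Γ) (s : Sp Γ B C) (σ : HSub A Δ Γ')
               → hsubSp A (renSp ρ s) σ ≡ hsubSp A s (λ x → σ (ρ x))
    hsubSp-ren A ρ [] σ = refl
    hsubSp-ren A ρ (n ∷ s) σ = cong₂ _∷_ (hsub-ren A ρ n σ) (hsubSp-ren A ρ s σ)

  mutual
    hsub-var : ∀ {Γ Δ B} (A : Ty) (ρ : Ren Δ Γ) (u : Nf Γ B)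
             → hsub A u (λ x → var (ρ x)) ≡ ren ρ u
    hsub-var A ρ (lam u) = cong lam (trans (hsub-cong A u λ { vz → refl ; (vs x) → refl })
                                           (hsub-var A (liftRen ρ) u))
    hsub-var A ρ (ne x sp) = cong (ne (ρ x)) (hsubSp-var A ρ sp)

    hsubSp-var : ∀ {Γ Δ B C} (A : Ty) (ρ : Ren Δ Γ) (s : Sp Γ B C)
               → hsubSp A s (λ x → var (ρ x)) ≡ renSp ρ s
    hsubSp-var A ρ [] = refl
    hsubSp-var A ρ (n ∷ s) = cong₂ _∷_ (hsub-var A ρ n) (hsubSp-var A ρ s)

  hsub-wk-single : ∀ {Δ B} (A : Ty) (k : Nf Δ B) (m : Nf Δ A)
                 → hsub A (ren wk k) (single m) ≡ k
  hsub-wk-single A k m = begin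
    hsub A (ren wk k) (single m)  ≡⟨ hsub-ren A wk k (single m) ⟩
    hsub A k (λ x → var x)        ≡⟨ hsub-var A (λ x → x) k ⟩
    ren (λ x → x) k               ≡⟨ ren-id k ⟩
    k                             ∎

  liftH-renEnt : ∀ {A Θ Δ Γ B} (ρ : Ren Θ Δ) (σ : HSub A Δ Γ) {C} (x : Var (Γ ▷ B) C)
               → liftH (λ y → renEnt ρ (σ y)) x ≡ renEnt (liftRen ρ) (liftH σ x)
  liftH-renEnt ρ σ vz = refl
  liftH-renEnt ρ σ (vs x) with σ x
  ... | var y = refl
  ... | nf n = cong nf (ren-wk-liftRen ρ n)

  mutual
    ren-hsub : ∀ {Θ Δ Γ B} (A : Ty) (ρ : Ren Θ Δ) (u : Nf Γ B) (σ : HSub A Δ Γ)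
             → ren ρ (hsub A u σ) ≡ hsub A u (λ x → renEnt ρ (σ x))
    ren-hsub A ρ (lam u) σ = cong lam (trans (ren-hsub A (liftRen ρ) u (liftH σ))
                                             (hsub-cong A u (λ x → sym (liftH-renEnt ρ σ x))))
    ren-hsub A ρ (ne x sp) σ = trans (ren-appEnt A ρ (σ x) (hsubSp A sp σ))
                                     (cong (appEnt A (renEnt ρ (σ x))) (ren-hsubSp A ρ sp σ))

    ren-hsubSp : ∀ {Θ Δ Γ B C} (A : Ty) (ρ : Ren Θ Δ) (s : Sp Γ B C) (σ : HSub A Δ Γ)
               → renSp ρ (hsubSp A s σ) ≡ hsubSp A s (λ x → renEnt ρ (σ x))
    ren-hsubSp A ρ [] σ = refl
    ren-hsubSp A ρ (n ∷ s) σ = cong₂ _∷_ (ren-hsub A ρ n σ) (ren-hsubSp A ρ s σ)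

    ren-appEnt : ∀ {Θ Δ C b} (A : Ty) (ρ : Ren Θ Δ) (e : Ent A Δ C) (s : Sp Δ C (ι b))
               → ren ρ (appEnt A e s) ≡ appEnt A (renEnt ρ e) (renSp ρ s)
    ren-appEnt A ρ (var y) s = refl
    ren-appEnt A ρ (nf n) s = ren-app A ρ n s

    ren-app : ∀ {Θ Δ C} (A : Ty) (ρ : Ren Θ Δ) (n : Nf Δ A) (s : Sp Δ A C)
            → ren ρ (app A n s) ≡ app A (ren ρ n) (renSp ρ s)
    ren-app A ρ n [] = refl
    ren-app (A ⇒ B) ρ (lam u) (m ∷ s) =
      trans (ren-app B ρ _ s) (cong (λ z → app B z (renSp ρ s)) ren-hsub-single)
      where
        ren-hsub-single : ren ρ (hsub A u (single m)) ≡ hsub A (ren (liftRen ρ) u) (single (ren ρ m))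
        ren-hsub-single = begin
          ren ρ (hsub A u (single m))
            ≡⟨ ren-hsub A ρ u (single m) ⟩
          hsub A u (λ x → renEnt ρ (single m x))
            ≡⟨ hsub-cong A u (λ { vz → refl ; (vs x) → refl }) ⟩
          hsub A u (λ x → single (ren ρ m) (liftRen ρ x))
            ≡⟨ sym (hsub-ren A (liftRen ρ) u (single (ren ρ m))) ⟩
          hsub A (ren (liftRen ρ) u) (single (ren ρ m))
            ∎

  app-++ : ∀ {Δ A B C} (n : Nf Δ A) (s : Sp Δ A B) (s' : Sp Δ B C)
         → app A n (s ++ s') ≡ app B (app A n s) s'
  app-++ n [] s' = refl
  app-++ {A = A ⇒ B} (lam u) (m ∷ s) s' = app-++ (hsub A u (single m)) s s'

module ParallelSubstitution (𝓑 : Set) where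
  open NormalForms 𝓑
  open Renaming 𝓑
  open HereditarySubstitution 𝓑

  Val : Con → Ty → Set
  Val Δ C = Var Δ C ⊎ Nf Δ C

  PSub : Con → Con → Set
  PSub Δ Γ = ∀ {C} → Var Γ C → Val Δ C

  renVal : ∀ {Δ Γ C} → Ren Δ Γ → Val Γ C → Val Δ C
  renVal ρ (inj₁ y) = inj₁ (ρ y)
  renVal ρ (inj₂ n) = inj₂ (ren ρ n)

  liftP : ∀ {Δ Γ B} → PSub Δ Γ → PSub (Δ ▷ B) (Γ ▷ B)
  liftP σ vz = inj₁ vz
  liftP σ (vs x) = renVal wk (σ x)

  appVal : ∀ {Δ C b} → Val Δ C → Sp Δ C (ι b) → Nf Δ (ι b)
  appVal (inj₁ y) sp = ne y sp
  appVal {C = C} (inj₂ n) sp = app C n sp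

  mutual
    psub : ∀ {Γ Δ B} → Nf Γ B → PSub Δ Γ → Nf Δ B
    psub (lam u) σ = lam (psub u (liftP σ))
    psub (ne x sp) σ = appVal (σ x) (psubSp sp σ)

    psubSp : ∀ {Γ Δ B C} → Sp Γ B C → PSub Δ Γ → Sp Δ B C
    psubSp [] σ = []
    psubSp (n ∷ sp) σ = psub n σ ∷ psubSp sp σ

  mutual
    psub-cong : ∀ {Γ Δ B} (u : Nf Γ B) {σ σ' : PSub Δ Γ}
              → (∀ {C} (x : Var Γ C) → σ x ≡ σ' x) → psub u σ ≡ psub u σ'
    psub-cong (lam u) h = cong lam (psub-cong u λ { vz → refl ; (vs x) → cong (renVal wk) (h x) })
    psub-cong (ne x sp) h = cong₂ appVal (h x) (psubSp-cong sp h)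

    psubSp-cong : ∀ {Γ Δ B C} (s : Sp Γ B C) {σ σ' : PSub Δ Γ}
                → (∀ {C} (x : Var Γ C) → σ x ≡ σ' x) → psubSp s σ ≡ psubSp s σ'
    psubSp-cong [] h = refl
    psubSp-cong (n ∷ s) h = cong₂ _∷_ (psub-cong n h) (psubSp-cong s h)

  mutual
    psub-ren : ∀ {Γ Γ' Δ B} (ρ : Ren Γ' Γ) (u : Nf Γ B) (σ : PSub Δ Γ')
             → psub (ren ρ u) σ ≡ psub u (λ x → σ (ρ x))
    psub-ren ρ (lam u) σ = cong lam (trans (psub-ren (liftRen ρ) u (liftP σ))
                                           (psub-cong u λ { vz → refl ; (vs x) → refl }))
    psub-ren ρ (ne x sp) σ = cong (appVal (σ (ρ x))) (psubSp-ren ρ sp σ)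

    psubSp-ren : ∀ {Γ Γ' Δ B C} (ρ : Ren Γ' Γ) (s : Sp Γ B C) (σ : PSub Δ Γ')
               → psubSp (renSp ρ s) σ ≡ psubSp s (λ x → σ (ρ x))
    psubSp-ren ρ [] σ = refl
    psubSp-ren ρ (n ∷ s) σ = cong₂ _∷_ (psub-ren ρ n σ) (psubSp-ren ρ s σ)

  mutual
    psub-var : ∀ {Γ Δ B} (ρ : Ren Δ Γ) (u : Nf Γ B) → psub u (λ x → inj₁ (ρ x)) ≡ ren ρ u
    psub-var ρ (lam u) = cong lam (trans (psub-cong u λ { vz → refl ; (vs x) → refl })
                                         (psub-var (liftRen ρ) u))
    psub-var ρ (ne x sp) = cong (ne (ρ x)) (psubSp-var ρ sp)

    psubSp-var : ∀ {Γ Δ B C} (ρ : Ren Δ Γ) (s : Sp Γ B C)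
               → psubSp s (λ x → inj₁ (ρ x)) ≡ renSp ρ s
    psubSp-var ρ [] = refl
    psubSp-var ρ (n ∷ s) = cong₂ _∷_ (psub-var ρ n) (psubSp-var ρ s)

  liftP-renVal : ∀ {Θ Δ Γ B} (ρ : Ren Θ Δ) (σ : PSub Δ Γ) {C} (x : Var (Γ ▷ B) C)
               → liftP (λ y → renVal ρ (σ y)) x ≡ renVal (liftRen ρ) (liftP σ x)
  liftP-renVal ρ σ vz = refl
  liftP-renVal ρ σ (vs x) with σ x
  ... | inj₁ y = refl
  ... | inj₂ n = cong inj₂ (ren-wk-liftRen ρ n)

  mutual
    ren-psub : ∀ {Θ Δ Γ B} (ρ : Ren Θ Δ) (u : Nf Γ B) (σ : PSub Δ Γ)
             → ren ρ (psub u σ) ≡ psub u (λ x → renVal ρ (σ x))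
    ren-psub ρ (lam u) σ = cong lam (trans (ren-psub (liftRen ρ) u (liftP σ))
                                           (psub-cong u (λ x → sym (liftP-renVal ρ σ x))))
    ren-psub ρ (ne x sp) σ = trans (ren-appVal ρ (σ x) (psubSp sp σ))
                                   (cong (appVal (renVal ρ (σ x))) (ren-psubSp ρ sp σ))

    ren-psubSp : ∀ {Θ Δ Γ B C} (ρ : Ren Θ Δ) (s : Sp Γ B C) (σ : PSub Δ Γ)
               → renSp ρ (psubSp s σ) ≡ psubSp s (λ x → renVal ρ (σ x))
    ren-psubSp ρ [] σ = refl
    ren-psubSp ρ (n ∷ s) σ = cong₂ _∷_ (ren-psub ρ n σ) (ren-psubSp ρ s σ)

    ren-appVal : ∀ {Θ Δ C b} (ρ : Ren Θ Δ) (e : Val Δ C) (s : Sp Δ C (ι b))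
               → ren ρ (appVal e s) ≡ appVal (renVal ρ e) (renSp ρ s)
    ren-appVal ρ (inj₁ y) s = refl
    ren-appVal {C = C} ρ (inj₂ n) s = ren-app C ρ n s

  psubSp-++ : ∀ {Γ Δ A B C} (s : Sp Γ A B) (s' : Sp Γ B C) (σ : PSub Δ Γ)
            → psubSp (s ++ s') σ ≡ psubSp s σ ++ psubSp s' σ
  psubSp-++ [] s' σ = refl
  psubSp-++ (n ∷ s) s' σ = cong (psub n σ ∷_) (psubSp-++ s s' σ)

  psubSp-wk : ∀ {Γ Δ A C B} (s : Sp Γ A C) (σ : PSub Δ Γ)
            → psubSp (renSp wk s) (liftP {B = B} σ) ≡ renSp wk (psubSp s σ)
  psubSp-wk s σ = trans (psubSp-ren wk s (liftP σ)) (sym (ren-psubSp wk s σ))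

  ent→val : ∀ {A Δ C} → Ent A Δ C → Val Δ C
  ent→val (var y) = inj₁ y
  ent→val (nf n) = inj₂ n

  ⌊_⌋ : ∀ {A Δ Γ} → HSub A Δ Γ → PSub Δ Γ
  ⌊ σ ⌋ x = ent→val (σ x)

  appEnt≡appVal : ∀ {A Δ C b} (e : Ent A Δ C) (s : Sp Δ C (ι b))
                → appEnt A e s ≡ appVal (ent→val e) s
  appEnt≡appVal (var y) s = refl
  appEnt≡appVal (nf n) s = refl

  ent→val-renEnt : ∀ {A Δ Γ C} (ρ : Ren Δ Γ) (e : Ent A Γ C)
                 → ent→val (renEnt ρ e) ≡ renVal ρ (ent→val e)
  ent→val-renEnt ρ (var y) = refl
  ent→val-renEnt ρ (nf n) = refl

  mutual
    hsub≡psub : ∀ {Γ Δ B} (A : Ty) (u : Nf Γ B) (σ : HSub A Δ Γ) → hsub A u σ ≡ psub u ⌊ σ ⌋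
    hsub≡psub A (lam u) σ = cong lam (trans (hsub≡psub A u (liftH σ))
      (psub-cong u λ { vz → refl ; (vs x) → ent→val-renEnt wk (σ x) }))
    hsub≡psub A (ne x sp) σ =
      trans (appEnt≡appVal (σ x) _) (cong (appVal (ent→val (σ x))) (hsubSp≡psubSp A sp σ))

    hsubSp≡psubSp : ∀ {Γ Δ B C} (A : Ty) (s : Sp Γ B C) (σ : HSub A Δ Γ)
                  → hsubSp A s σ ≡ psubSp s ⌊ σ ⌋
    hsubSp≡psubSp A [] σ = refl
    hsubSp≡psubSp A (n ∷ s) σ = cong₂ _∷_ (hsub≡psub A n σ) (hsubSp≡psubSp A s σ)

  psubSp-wk-single : ∀ {Δ A B} (A' : Ty) (s : Sp Δ A B) (m : Nf Δ A')
                   → psubSp (renSp wk s) ⌊ single m ⌋ ≡ s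
  psubSp-wk-single A' s m = begin
    psubSp (renSp wk s) ⌊ single m ⌋  ≡⟨ psubSp-ren wk s _ ⟩
    psubSp s (λ x → inj₁ x)           ≡⟨ psubSp-var (λ x → x) s ⟩
    renSp (λ x → x) s                 ≡⟨ renSp-id s ⟩
    s                                 ∎

module EtaExpansion (𝓑 : Set) where
  open NormalForms 𝓑
  open Renaming 𝓑
  open HereditarySubstitution 𝓑
  open ParallelSubstitution 𝓑

  eta : ∀ {Γ A} (B : Ty) → Var Γ A → Sp Γ A B → Nf Γ B
  eta (ι b) x sp = ne x sp
  eta (B ⇒ C) x sp = lam (eta C (vs x) (renSp wk sp ++ (eta B vz [] ∷ [])))

  ηvar : ∀ {Γ C} → Var Γ C → Nf Γ C
  ηvar {C = C} x = eta C x []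

  ren-eta : ∀ {Δ Γ A} (B : Ty) (ρ : Ren Δ Γ) (x : Var Γ A) (s : Sp Γ A B)
          → ren ρ (eta B x s) ≡ eta B (ρ x) (renSp ρ s)
  ren-eta (ι b) ρ x s = refl
  ren-eta (B ⇒ C) ρ x s =
    cong lam (trans (ren-eta C (liftRen ρ) (vs x) _)
      (cong (eta C (vs (ρ x)))
        (trans (renSp-++ (liftRen ρ) (renSp wk s) _)
          (cong₂ _++_ (sym (renSp-wk-liftRen ρ s)) (cong (_∷ []) (ren-eta B (liftRen ρ) vz []))))))

  psub-eta-var : ∀ {Γ Δ A} (B : Ty) (y : Var Γ A) (s : Sp Γ A B) (σ : PSub Δ Γ) {z : Var Δ A}
               → σ y ≡ inj₁ z → psub (eta B y s) σ ≡ eta B z (psubSp s σ)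
  psub-eta-var (ι b) y s σ eq rewrite eq = refl
  psub-eta-var (B ⇒ C) y s σ {z} eq =
    cong lam (trans (psub-eta-var C (vs y) _ (liftP σ) (cong (renVal wk) eq))
      (cong (eta C (vs z))
        (trans (psubSp-++ (renSp wk s) _ (liftP σ))
          (cong₂ _++_ (psubSp-wk s σ) (cong (_∷ []) (psub-eta-var B vz [] (liftP σ) refl))))))

  -- Agreement up to replacing a variable by its η-expansion, allowed only at
  -- types satisfying P; eta-law below needs P to be a single type to keep its
  -- mutual recursion with app-eta structural.
  data EtaRel (P : Ty → Set) {Δ : Con} : ∀ {C} → Val Δ C → Val Δ C → Set where
    same   : ∀ {C} {e : Val Δ C} → EtaRel P e e
    η-expd : ∀ {C} → P C → (y : Var Δ C) → EtaRel P (inj₂ (ηvar y)) (inj₁ y)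

  EtaRel-wk : ∀ {P Δ C B} {e e' : Val Δ C} → EtaRel P e e'
            → EtaRel P (renVal (wk {B = B}) e) (renVal wk e')
  EtaRel-wk same = same
  EtaRel-wk {P} {C = C} (η-expd p y) =
    subst (λ z → EtaRel P (inj₂ z) (inj₁ (vs y))) (sym (ren-eta C wk y [])) (η-expd p (vs y))

  module EtaCongruence (P : Ty → Set)
    (app-ηvar : ∀ {Δ C b} → P C → (y : Var Δ C) (s : Sp Δ C (ι b)) → app C (ηvar y) s ≡ ne y s)
    where

    appVal-cong : ∀ {Δ C b} {e e' : Val Δ C} → EtaRel P e e' → (s : Sp Δ C (ι b))
                → appVal e s ≡ appVal e' s
    appVal-cong same s = refl
    appVal-cong (η-expd p y) s = app-ηvar p y s

    mutual
      psub-cong-η : ∀ {Γ Δ B} (u : Nf Γ B) {σ σ' : PSub Δ Γ}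
                  → (∀ {C} (x : Var Γ C) → EtaRel P (σ x) (σ' x)) → psub u σ ≡ psub u σ'
      psub-cong-η (lam u) h = cong lam (psub-cong-η u λ { vz → same ; (vs x) → EtaRel-wk (h x) })
      psub-cong-η (ne x sp) {σ} {σ'} h =
        trans (appVal-cong (h x) (psubSp sp σ)) (cong (appVal (σ' x)) (psubSp-cong-η sp h))

      psubSp-cong-η : ∀ {Γ Δ B C} (s : Sp Γ B C) {σ σ' : PSub Δ Γ}
                    → (∀ {C} (x : Var Γ C) → EtaRel P (σ x) (σ' x)) → psubSp s σ ≡ psubSp s σ'
      psubSp-cong-η [] h = refl
      psubSp-cong-η (n ∷ s) h = cong₂ _∷_ (psub-cong-η n h) (psubSp-cong-η s h)

  mutual
    app-eta : ∀ {Γ A b} (B : Ty) (x : Var Γ A) (s₀ : Sp Γ A B) (s : Sp Γ B (ι b))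
            → app B (eta B x s₀) s ≡ ne x (s₀ ++ s)
    app-eta (ι b) x s₀ [] = cong (ne x) (sym (++-identityʳ s₀))
    app-eta (C ⇒ D) x s₀ (m ∷ s) = begin
      app D (hsub C (eta D (vs x) s₁) (single m)) s
        ≡⟨ cong (λ z → app D z s) (hsub≡psub C (eta D (vs x) s₁) (single m)) ⟩
      app D (psub (eta D (vs x) s₁) ⌊ single m ⌋) s
        ≡⟨ cong (λ z → app D z s) (psub-eta-var D (vs x) s₁ ⌊ single m ⌋ refl) ⟩
      app D (eta D x (psubSp s₁ ⌊ single m ⌋)) s
        ≡⟨ cong (λ z → app D (eta D x z) s) s₁[m] ⟩
      app D (eta D x (s₀ ++ (m ∷ []))) s
        ≡⟨ app-eta D x _ s ⟩
      ne x ((s₀ ++ (m ∷ [])) ++ s)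
        ≡⟨ cong (ne x) (++-assoc s₀ (m ∷ []) s) ⟩
      ne x (s₀ ++ (m ∷ s))
        ∎
      where
        s₁ = renSp wk s₀ ++ (ηvar vz ∷ [])
        s₁[m] : psubSp s₁ ⌊ single m ⌋ ≡ s₀ ++ (m ∷ [])
        s₁[m] = trans (psubSp-++ (renSp wk s₀) _ _)
                      (cong₂ _++_ (psubSp-wk-single C s₀ m)
                                  (cong (_∷ []) (psub-eta-nf C vz [] ⌊ single m ⌋ refl)))

    psub-eta-nf : ∀ {Γ Δ C} (B : Ty) (x : Var Γ C) (s : Sp Γ C B) (σ : PSub Δ Γ) {n : Nf Δ C}
                → σ x ≡ inj₂ n → psub (eta B x s) σ ≡ app C n (psubSp s σ)
    psub-eta-nf (ι b) x s σ eq rewrite eq = refl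
    psub-eta-nf {C = C} (D₁ ⇒ D₂) x s σ {n} eq = begin
      lam (psub (eta D₂ (vs x) s₁) (liftP σ))
        ≡⟨ cong lam (psub-eta-nf D₂ (vs x) _ (liftP σ) (cong (renVal wk) eq)) ⟩
      lam (app C (ren wk n) (psubSp s₁ (liftP σ)))
        ≡⟨ cong (λ z → lam (app C (ren wk n) z)) s₁[σ] ⟩
      lam (app C (ren wk n) (renSp wk (psubSp s σ) ++ (ηvar vz ∷ [])))
        ≡⟨ cong lam (app-++ {B = D₁ ⇒ D₂} (ren wk n) (renSp wk (psubSp s σ)) (ηvar vz ∷ [])) ⟩
      lam (app (D₁ ⇒ D₂) (app C (ren wk n) (renSp wk (psubSp s σ))) (ηvar vz ∷ []))
        ≡⟨ cong (λ z → lam (app (D₁ ⇒ D₂) z (ηvar vz ∷ []))) (sym (ren-app C wk n (psubSp s σ))) ⟩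
      lam (app (D₁ ⇒ D₂) (ren wk (app C n (psubSp s σ))) (ηvar vz ∷ []))
        ≡⟨ eta-law D₁ D₂ (app C n (psubSp s σ)) ⟩
      app C n (psubSp s σ)
        ∎
      where
        s₁ = renSp wk s ++ (ηvar vz ∷ [])
        s₁[σ] : psubSp s₁ (liftP σ) ≡ renSp wk (psubSp s σ) ++ (ηvar vz ∷ [])
        s₁[σ] = trans (psubSp-++ (renSp wk s) _ (liftP σ))
                      (cong₂ _++_ (psubSp-wk s σ) (cong (_∷ []) (psub-eta-var D₁ vz [] (liftP σ) refl)))

    eta-law : ∀ {Δ} (D₁ D₂ : Ty) (k : Nf Δ (D₁ ⇒ D₂))
            → lam (app (D₁ ⇒ D₂) (ren wk k) (ηvar vz ∷ [])) ≡ k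
    eta-law D₁ D₂ (lam w) = cong lam (begin
      hsub D₁ (ren (liftRen wk) w) (single (ηvar vz))
        ≡⟨ hsub≡psub D₁ (ren (liftRen wk) w) (single (ηvar vz)) ⟩
      psub (ren (liftRen wk) w) ⌊ single (ηvar vz) ⌋
        ≡⟨ psub-ren (liftRen wk) w _ ⟩
      psub w (λ x → ⌊ single (ηvar vz) ⌋ (liftRen wk x))
        ≡⟨ EtaCongruence.psub-cong-η (_≡ D₁) (λ { refl y s → app-eta D₁ y [] s }) w
             (λ { vz → η-expd refl vz ; (vs x) → same }) ⟩
      psub w (λ x → inj₁ x)
        ≡⟨ psub-var (λ x → x) w ⟩
      ren (λ x → x) w
        ≡⟨ ren-id w ⟩
      w ∎)

module SubstitutionLemma (𝓑 : Set) where
  open NormalForms 𝓑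
  open Renaming 𝓑
  open HereditarySubstitution 𝓑
  open ParallelSubstitution 𝓑

  hsubVal : ∀ {Φ Θ C} (D : Ty) → Val Φ C → HSub D Θ Φ → Val Θ C
  hsubVal D (inj₁ y) σ = ent→val (σ y)
  hsubVal D (inj₂ n) σ = inj₂ (hsub D n σ)

  psubVal : ∀ {Ψ Θ C} → Val Ψ C → PSub Θ Ψ → Val Θ C
  psubVal (inj₁ y) τ = τ y
  psubVal (inj₂ n) τ = inj₂ (psub n τ)

  hsubVal-wk : ∀ {Φ Θ C B} (D : Ty) (e : Val Φ C) (σ : HSub D Θ Φ)
             → hsubVal D (renVal (wk {B = B}) e) (liftH σ) ≡ renVal wk (hsubVal D e σ)
  hsubVal-wk D (inj₁ y) σ = ent→val-renEnt wk (σ y)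
  hsubVal-wk D (inj₂ n) σ = cong inj₂ (trans (hsub-ren D wk n (liftH σ)) (sym (ren-hsub D wk n σ)))

  hsubVal-wk-ent : ∀ {Φ Θ C B A} (D : Ty) (e : Ent A Φ C) (σ : HSub D Θ Φ)
                 → hsubVal D (ent→val (renEnt (wk {B = B}) e)) (liftH σ)
                 ≡ renVal wk (hsubVal D (ent→val e) σ)
  hsubVal-wk-ent D e σ =
    trans (cong (λ z → hsubVal D z (liftH σ)) (ent→val-renEnt wk e)) (hsubVal-wk D (ent→val e) σ)

  psubVal-wk : ∀ {Ψ Θ C B} (e : Val Ψ C) (τ : PSub Θ Ψ)
             → psubVal (renVal (wk {B = B}) e) (liftP τ) ≡ renVal wk (psubVal e τ)
  psubVal-wk (inj₁ y) τ = refl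
  psubVal-wk (inj₂ n) τ = cong inj₂ (trans (psub-ren wk n (liftP τ)) (sym (ren-psub wk n τ)))

  mutual
    hsub-app : ∀ {Δ Θ C} (D A : Ty) (n : Nf Δ D) (s : Sp Δ D C) (τ : HSub A Θ Δ)
             → hsub A (app D n s) τ ≡ app D (hsub A n τ) (hsubSp A s τ)
    hsub-app D A n [] τ = refl
    hsub-app (D₁ ⇒ D₂) A (lam w) (m ∷ s) τ =
      trans (hsub-app D₂ A (hsub D₁ w (single m)) s τ)
        (cong (λ z → app D₂ z (hsubSp A s τ))
          (hsub-hsub D₁ A w (single m) τ (liftH τ) (single (hsub A m τ)) agree))
      where
        agree : ∀ {C} (x : Var _ C)
              → hsubVal A (ent→val (single m x)) τ ≡ hsubVal D₁ (ent→val (liftH τ x)) (single (hsub A m τ))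
        agree vz = refl
        agree (vs x) with τ x
        ... | var y = refl
        ... | nf k = cong inj₂ (sym (hsub-wk-single D₁ k (hsub A m τ)))

    hsub-appEnt : ∀ {Δ Θ C b} (D A : Ty) (e : Ent D Δ C) (s : Sp Δ C (ι b)) (τ : HSub A Θ Δ)
                → hsub A (appEnt D e s) τ ≡ appVal (hsubVal A (ent→val e) τ) (hsubSp A s τ)
    hsub-appEnt D A (var y) s τ = appEnt≡appVal (τ y) _
    hsub-appEnt D A (nf n) s τ = hsub-app D A n s τ

    hsub-hsub : ∀ {Γ Ψ Θ Φ B} (D A : Ty) (u : Nf Γ B) (σ : HSub D Ψ Γ) (τ : HSub A Θ Ψ)
                (τ' : HSub A Φ Γ) (σ' : HSub D Θ Φ)
              → (∀ {C} (x : Var Γ C) → hsubVal A (ent→val (σ x)) τ ≡ hsubVal D (ent→val (τ' x)) σ')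
              → hsub A (hsub D u σ) τ ≡ hsub D (hsub A u τ') σ'
    hsub-hsub D A (lam u) σ τ τ' σ' h =
      cong lam (hsub-hsub D A u (liftH σ) (liftH τ) (liftH τ') (liftH σ') h')
      where
        h' : ∀ {C} (x : Var _ C)
           → hsubVal A (ent→val (liftH σ x)) (liftH τ) ≡ hsubVal D (ent→val (liftH τ' x)) (liftH σ')
        h' vz = refl
        h' (vs x) = trans (hsubVal-wk-ent A (σ x) τ)
                          (trans (cong (renVal wk) (h x)) (sym (hsubVal-wk-ent D (τ' x) σ')))
    hsub-hsub D A (ne x sp) σ τ τ' σ' h =
      trans (hsub-appEnt D A (σ x) (hsubSp D sp σ) τ)
        (trans (cong₂ appVal (h x) (hsubSp-hsubSp D A sp σ τ τ' σ' h))
          (sym (hsub-appEnt A D (τ' x) (hsubSp A sp τ') σ')))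

    hsubSp-hsubSp : ∀ {Γ Ψ Θ Φ B C} (D A : Ty) (s : Sp Γ B C) (σ : HSub D Ψ Γ) (τ : HSub A Θ Ψ)
                    (τ' : HSub A Φ Γ) (σ' : HSub D Θ Φ)
                  → (∀ {C} (x : Var Γ C) → hsubVal A (ent→val (σ x)) τ ≡ hsubVal D (ent→val (τ' x)) σ')
                  → hsubSp A (hsubSp D s σ) τ ≡ hsubSp D (hsubSp A s τ') σ'
    hsubSp-hsubSp D A [] σ τ τ' σ' h = refl
    hsubSp-hsubSp D A (n ∷ s) σ τ τ' σ' h =
      cong₂ _∷_ (hsub-hsub D A n σ τ τ' σ' h) (hsubSp-hsubSp D A s σ τ τ' σ' h)

  hsub-appVal : ∀ {Φ Θ C b} (D : Ty) (e : Val Φ C) (s : Sp Φ C (ι b)) (σ : HSub D Θ Φ)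
              → hsub D (appVal e s) σ ≡ appVal (hsubVal D e σ) (hsubSp D s σ)
  hsub-appVal D (inj₁ y) s σ = appEnt≡appVal (σ y) _
  hsub-appVal {C = C} D (inj₂ n) s σ = hsub-app C D n s σ

  -- Here τ' is parallel, so its entries have arbitrary types and this recursion
  -- could not reach hsub-appVal itself; hence the hereditary-only version above.
  mutual
    psub-app : ∀ {Δ Θ C} (D : Ty) (n : Nf Δ D) (s : Sp Δ D C) (τ : PSub Θ Δ)
             → psub (app D n s) τ ≡ app D (psub n τ) (psubSp s τ)
    psub-app D n [] τ = refl
    psub-app (D₁ ⇒ D₂) (lam w) (m ∷ s) τ =
      trans (psub-app D₂ (hsub D₁ w (single m)) s τ)
        (cong (λ z → app D₂ z (psubSp s τ))
          (psub-hsub D₁ w (single m) τ (liftP τ) (single (psub m τ)) agree))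
      where
        agree : ∀ {C} (x : Var _ C)
              → psubVal (ent→val (single m x)) τ ≡ hsubVal D₁ (liftP τ x) (single (psub m τ))
        agree vz = refl
        agree (vs x) with τ x
        ... | inj₁ y = refl
        ... | inj₂ k = cong inj₂ (sym (hsub-wk-single D₁ k (psub m τ)))

    psub-appEnt : ∀ {Δ Θ C b} (D : Ty) (e : Ent D Δ C) (s : Sp Δ C (ι b)) (τ : PSub Θ Δ)
                → psub (appEnt D e s) τ ≡ appVal (psubVal (ent→val e) τ) (psubSp s τ)
    psub-appEnt D (var y) s τ = refl
    psub-appEnt D (nf n) s τ = psub-app D n s τ

    psub-hsub : ∀ {Γ Ψ Θ Φ B} (D : Ty) (u : Nf Γ B) (σ : HSub D Ψ Γ) (τ : PSub Θ Ψ)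
                (τ' : PSub Φ Γ) (σ' : HSub D Θ Φ)
              → (∀ {C} (x : Var Γ C) → psubVal (ent→val (σ x)) τ ≡ hsubVal D (τ' x) σ')
              → psub (hsub D u σ) τ ≡ hsub D (psub u τ') σ'
    psub-hsub D (lam u) σ τ τ' σ' h =
      cong lam (psub-hsub D u (liftH σ) (liftP τ) (liftP τ') (liftH σ') h')
      where
        h' : ∀ {C} (x : Var _ C)
           → psubVal (ent→val (liftH σ x)) (liftP τ) ≡ hsubVal D (liftP τ' x) (liftH σ')
        h' vz = refl
        h' (vs x) = begin
          psubVal (ent→val (renEnt wk (σ x))) (liftP τ)
            ≡⟨ cong (λ z → psubVal z (liftP τ)) (ent→val-renEnt wk (σ x)) ⟩
          psubVal (renVal wk (ent→val (σ x))) (liftP τ)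
            ≡⟨ psubVal-wk (ent→val (σ x)) τ ⟩
          renVal wk (psubVal (ent→val (σ x)) τ)
            ≡⟨ cong (renVal wk) (h x) ⟩
          renVal wk (hsubVal D (τ' x) σ')
            ≡⟨ sym (hsubVal-wk D (τ' x) σ') ⟩
          hsubVal D (renVal wk (τ' x)) (liftH σ')
            ∎
    psub-hsub D (ne x sp) σ τ τ' σ' h =
      trans (psub-appEnt D (σ x) (hsubSp D sp σ) τ)
        (trans (cong₂ appVal (h x) (psubSp-hsubSp D sp σ τ τ' σ' h))
          (sym (hsub-appVal D (τ' x) (psubSp sp τ') σ')))

    psubSp-hsubSp : ∀ {Γ Ψ Θ Φ B C} (D : Ty) (s : Sp Γ B C) (σ : HSub D Ψ Γ) (τ : PSub Θ Ψ)
                    (τ' : PSub Φ Γ) (σ' : HSub D Θ Φ)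
                  → (∀ {C} (x : Var Γ C) → psubVal (ent→val (σ x)) τ ≡ hsubVal D (τ' x) σ')
                  → psubSp (hsubSp D s σ) τ ≡ hsubSp D (psubSp s τ') σ'
    psubSp-hsubSp D [] σ τ τ' σ' h = refl
    psubSp-hsubSp D (n ∷ s) σ τ τ' σ' h =
      cong₂ _∷_ (psub-hsub D n σ τ τ' σ' h) (psubSp-hsubSp D s σ τ τ' σ' h)

  _⨾_ : ∀ {Γ Ψ Θ} → PSub Ψ Γ → PSub Θ Ψ → PSub Θ Γ
  (σ ⨾ τ) x = psubVal (σ x) τ

  psub-appVal : ∀ {Ψ Θ C b} (e : Val Ψ C) (s : Sp Ψ C (ι b)) (τ : PSub Θ Ψ)
              → psub (appVal e s) τ ≡ appVal (psubVal e τ) (psubSp s τ)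
  psub-appVal (inj₁ y) s τ = refl
  psub-appVal {C = C} (inj₂ n) s τ = psub-app C n s τ

  mutual
    psub-assoc : ∀ {Γ Ψ Θ B} (u : Nf Γ B) (σ : PSub Ψ Γ) (τ : PSub Θ Ψ)
               → psub (psub u σ) τ ≡ psub u (σ ⨾ τ)
    psub-assoc (lam u) σ τ = cong lam (trans (psub-assoc u (liftP σ) (liftP τ))
                                             (psub-cong u λ { vz → refl ; (vs x) → psubVal-wk (σ x) τ }))
    psub-assoc (ne x sp) σ τ = trans (psub-appVal (σ x) (psubSp sp σ) τ)
                                     (cong (appVal (psubVal (σ x) τ)) (psubSp-assoc sp σ τ))

    psubSp-assoc : ∀ {Γ Ψ Θ B C} (s : Sp Γ B C) (σ : PSub Ψ Γ) (τ : PSub Θ Ψ)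
                 → psubSp (psubSp s σ) τ ≡ psubSp s (σ ⨾ τ)
    psubSp-assoc [] σ τ = refl
    psubSp-assoc (n ∷ s) σ τ = cong₂ _∷_ (psub-assoc n σ τ) (psubSp-assoc s σ τ)

module TermModel (𝓑 : Set) where
  open NormalForms 𝓑
  open Renaming 𝓑
  open HereditarySubstitution 𝓑
  open ParallelSubstitution 𝓑
  open EtaExpansion 𝓑
  open SubstitutionLemma 𝓑

  data Sub (Δ : Con) : Con → Set where
    ε   : Sub Δ ε
    _,_ : ∀ {Γ A} → Sub Δ Γ → Nf Δ A → Sub Δ (Γ ▷ A)

  lookup : ∀ {Δ Γ C} → Sub Δ Γ → Var Γ C → Nf Δ C
  lookup (σ , a) vz = a
  lookup (σ , a) (vs x) = lookup σ x

  tabulate : ∀ {Δ Γ} → (∀ {C} → Var Γ C → Nf Δ C) → Sub Δ Γ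
  tabulate {Γ = ε} f = ε
  tabulate {Γ = Γ ▷ A} f = tabulate (λ x → f (vs x)) , f vz

  lookup-tabulate : ∀ {Δ Γ C} (f : ∀ {C} → Var Γ C → Nf Δ C) (x : Var Γ C)
                  → lookup (tabulate f) x ≡ f x
  lookup-tabulate f vz = refl
  lookup-tabulate f (vs x) = lookup-tabulate (λ y → f (vs y)) x

  Sub-ext : ∀ {Δ Γ} {σ σ' : Sub Δ Γ} → (∀ {C} (x : Var Γ C) → lookup σ x ≡ lookup σ' x) → σ ≡ σ'
  Sub-ext {σ = ε} {ε} h = refl
  Sub-ext {σ = σ , a} {σ' , a'} h = cong₂ _,_ (Sub-ext (λ x → h (vs x))) (h vz)

  ⟪_⟫ : ∀ {Δ Γ} → Sub Δ Γ → PSub Δ Γ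
  ⟪ σ ⟫ x = inj₂ (lookup σ x)

  infixl 8 _[_]
  _[_] : ∀ {Δ Γ A} → Nf Γ A → Sub Δ Γ → Nf Δ A
  u [ σ ] = psub u ⟪ σ ⟫

  idS : ∀ {Γ} → Sub Γ Γ
  idS = tabulate ηvar

  infixr 9 _∘S_
  _∘S_ : ∀ {Γ Δ Θ} → Sub Δ Γ → Sub Θ Δ → Sub Θ Γ
  σ ∘S τ = tabulate (λ x → lookup σ x [ τ ])

  pS : ∀ {Γ A} → Sub (Γ ▷ A) Γ
  pS = tabulate (λ x → ηvar (vs x))

  ηvar[] : ∀ {Δ Γ C} (x : Var Γ C) (σ : Sub Δ Γ) → ηvar x [ σ ] ≡ lookup σ x
  ηvar[] {C = C} x σ = psub-eta-nf C x [] ⟪ σ ⟫ refl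

  app-ηvar : ∀ {Δ C b} (y : Var Δ C) (s : Sp Δ C (ι b)) → app C (ηvar y) s ≡ ne y s
  app-ηvar {C = C} y s = app-eta C y [] s

  open EtaCongruence (λ _ → ⊤) (λ _ → app-ηvar)

  η-expd-≡ : ∀ {Δ C} {n : Nf Δ C} (y : Var Δ C) → n ≡ ηvar y → EtaRel (λ _ → ⊤) (inj₂ n) (inj₁ y)
  η-expd-≡ y refl = η-expd tt y

  []-renaming : ∀ {Δ Γ B} (ρ : Ren Δ Γ) (σ : Sub Δ Γ) (u : Nf Γ B)
              → (∀ {C} (x : Var Γ C) → lookup σ x ≡ ηvar (ρ x)) → u [ σ ] ≡ ren ρ u
  []-renaming ρ σ u h = trans (psub-cong-η u (λ x → η-expd-≡ (ρ x) (h x))) (psub-var ρ u)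

  [idS] : ∀ {Γ B} (u : Nf Γ B) → u [ idS ] ≡ u
  [idS] u = trans ([]-renaming (λ x → x) idS u (lookup-tabulate ηvar)) (ren-id u)

  [pS] : ∀ {Γ A B} (u : Nf Γ B) → u [ pS {A = A} ] ≡ ren wk u
  [pS] u = []-renaming wk pS u (lookup-tabulate (λ x → ηvar (vs x)))

  [∘S] : ∀ {Γ Δ Θ A} (a : Nf Γ A) (γ : Sub Δ Γ) (δ : Sub Θ Δ) → a [ γ ∘S δ ] ≡ a [ γ ] [ δ ]
  [∘S] a γ δ = trans (psub-cong a (λ y → cong inj₂ (lookup-tabulate _ y))) (sym (psub-assoc a ⟪ γ ⟫ ⟪ δ ⟫))

  lookup-∘S : ∀ {Γ Δ Θ C} (γ : Sub Δ Γ) (δ : Sub Θ Δ) (x : Var Γ C)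
            → lookup (γ ∘S δ) x ≡ lookup γ x [ δ ]
  lookup-∘S γ δ = lookup-tabulate (λ x → lookup γ x [ δ ])

  idS-∘S : ∀ {Δ Γ} (γ : Sub Δ Γ) → idS ∘S γ ≡ γ
  idS-∘S γ = Sub-ext λ x → trans (lookup-∘S idS γ x)
    (trans (cong (_[ γ ]) (lookup-tabulate ηvar x)) (ηvar[] x γ))

  ∘S-idS : ∀ {Δ Γ} (γ : Sub Δ Γ) → γ ∘S idS ≡ γ
  ∘S-idS γ = Sub-ext λ x → trans (lookup-∘S γ idS x) ([idS] (lookup γ x))

  ∘S-assoc : ∀ {Γ Δ Θ Ξ} (γ : Sub Δ Γ) (δ : Sub Θ Δ) (θ : Sub Ξ Θ)
           → (γ ∘S δ) ∘S θ ≡ γ ∘S (δ ∘S θ)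
  ∘S-assoc γ δ θ = Sub-ext λ x → begin
    lookup ((γ ∘S δ) ∘S θ) x   ≡⟨ lookup-∘S (γ ∘S δ) θ x ⟩
    lookup (γ ∘S δ) x [ θ ]    ≡⟨ cong (_[ θ ]) (lookup-∘S γ δ x) ⟩
    lookup γ x [ δ ] [ θ ]     ≡⟨ sym ([∘S] (lookup γ x) δ θ) ⟩
    lookup γ x [ δ ∘S θ ]      ≡⟨ sym (lookup-∘S γ (δ ∘S θ) x) ⟩
    lookup (γ ∘S (δ ∘S θ)) x   ∎

  pS-∘S : ∀ {Δ Γ A} (γ : Sub Δ Γ) (a : Nf Δ A) → pS ∘S (γ , a) ≡ γ
  pS-∘S γ a = Sub-ext λ x → trans (lookup-∘S pS (γ , a) x)
    (trans (cong (_[ γ , a ]) (lookup-tabulate (λ y → ηvar (vs y)) x)) (ηvar[] (vs x) (γ , a)))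

  ,-unique : ∀ {Δ Γ A} (γ : Sub Δ Γ) (a : Nf Δ A) (δ : Sub Δ (Γ ▷ A))
           → pS ∘S δ ≡ γ → ηvar vz [ δ ] ≡ a → δ ≡ (γ , a)
  ,-unique γ a (δ , a') pδ≡γ qδ≡a =
    cong₂ _,_ (trans (sym (pS-∘S δ a')) pδ≡γ) (trans (sym (ηvar[] vz (δ , a'))) qδ≡a)

  Term : Scwf
  Term = record
    { Ctx = Con
    ; Hom = Sub
    ; id = idS
    ; _∘_ = _∘S_
    ; idˡ = idS-∘S
    ; idʳ = ∘S-idS
    ; assoc = ∘S-assoc
    ; ⋄ = ε
    ; ! = ε
    ; !-unique = λ { ε → refl }
    ; Ty = Ty
    ; Tm = Nf
    ; _[_] = _[_]
    ; [id] = [idS]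
    ; [∘] = [∘S]
    ; _·_ = _▷_
    ; p = pS
    ; q = ηvar vz
    ; ⟨_,_⟩ = _,_
    ; p∘⟨⟩ = pS-∘S
    ; q[⟨⟩] = λ γ a → ηvar[] vz (γ , a)
    ; ⟨⟩-unique = ,-unique
    }

  apN : ∀ {Γ A B} → Nf Γ (A ⇒ B) → Nf Γ A → Nf Γ B
  apN {A = A} {B} c a = app (A ⇒ B) c (a ∷ [])

  lam[]ₜ : ∀ {Δ Γ A B} (b : Nf (Γ ▷ A) B) (γ : Sub Δ Γ)
         → lam b [ γ ] ≡ lam (b [ (γ ∘S pS) , ηvar vz ])
  lam[]ₜ b γ = cong lam (sym (psub-cong-η b λ
    { vz → η-expd tt vz
    ; (vs x) → ≡⇒EtaRel (cong inj₂ (trans (lookup-∘S γ pS x) ([pS] (lookup γ x)))) }))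
    where
      ≡⇒EtaRel : ∀ {Δ C} {e e' : Val Δ C} → e ≡ e' → EtaRel (λ _ → ⊤) e e'
      ≡⇒EtaRel refl = same

  βₜ : ∀ {Γ A B} (b : Nf (Γ ▷ A) B) (a : Nf Γ A) → apN (lam b) a ≡ b [ idS , a ]
  βₜ {A = A} b a = trans (hsub≡psub A b (single a)) (sym (psub-cong-η b λ
    { vz → same
    ; (vs x) → η-expd-≡ x (lookup-tabulate ηvar x) }))

  ηₜ : ∀ {Γ A B} (c : Nf Γ (A ⇒ B)) → lam (apN (c [ pS ]) (ηvar vz)) ≡ c
  ηₜ {A = A} {B} c = trans (cong (λ z → lam (apN z (ηvar vz))) ([pS] c)) (eta-law A B c)

  TermArrow : ArrowStr Term
  TermArrow = record
    { _⇒_ = _⇒_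
    ; lam = lam
    ; ap = apN
    ; lam[] = lam[]ₜ
    ; ap[] = λ {_} {_} {A} {B} c a γ → psub-app (A ⇒ B) c (a ∷ []) ⟪ γ ⟫
    ; β = βₜ
    ; η = ηₜ
    }

  TermModel : BScwf 𝓑
  TermModel = record { scwf = Term ; arr = TermArrow ; ⟦_⟧ = ι }

  apN* : ∀ {Γ A C} → Nf Γ A → Sp Γ A C → Nf Γ C
  apN* h [] = h
  apN* h (m ∷ sp) = apN* (apN h m) sp

  apN*≡app : ∀ {Γ A C} (h : Nf Γ A) (sp : Sp Γ A C) → apN* h sp ≡ app A h sp
  apN*≡app h [] = refl
  apN*≡app {A = A ⇒ B} h (m ∷ sp) = trans (apN*≡app (apN h m) sp) (sym (app-++ h (m ∷ []) sp))

  ne≡apN* : ∀ {Γ A b} (x : Var Γ A) (sp : Sp Γ A (ι b)) → ne x sp ≡ apN* (ηvar x) sp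
  ne≡apN* {A = A} x sp = sym (trans (apN*≡app (ηvar x) sp) (app-eta A x [] sp))

  ηvar-vs : ∀ {Γ A C} (x : Var Γ C) → ηvar (vs {B = A} x) ≡ ηvar x [ pS ]
  ηvar-vs {C = C} x = sym (trans ([pS] (ηvar x)) (ren-eta C wk x []))

  apN-lam[pS] : ∀ {Γ A B} (u : Nf (Γ ▷ A) B) → apN (lam u [ pS ]) (ηvar vz) ≡ u
  apN-lam[pS] {Γ} {A} {B} u = lam-injective (ηₜ (lam u))
    where
      lam-injective : ∀ {a b : Nf (Γ ▷ A) B} → Nf.lam a ≡ lam b → a ≡ b
      lam-injective refl = refl

module Interpretation (𝓑 : Set) (X : BScwf 𝓑) where
  open NormalForms 𝓑
  open Renaming 𝓑
  open HereditarySubstitution 𝓑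
  open ParallelSubstitution 𝓑
  open EtaExpansion 𝓑
  open TermModel 𝓑 using (Sub; ε; _,_; lookup; ⟪_⟫; _[_]; tabulate; idS; _∘S_; pS)

  module S = Scwf (BScwf.scwf X)
  module SA = ArrowStr (BScwf.arr X)
  open ScwfProperties (BScwf.scwf X) using (⟨,⟩-∘)

  ⟦_⟧T : Ty → S.Ty
  ⟦ ι b ⟧T = BScwf.⟦_⟧ X b
  ⟦ A ⇒ B ⟧T = ⟦ A ⟧T SA.⇒ ⟦ B ⟧T

  ⟦_⟧C : Con → S.Ctx
  ⟦ ε ⟧C = S.⋄
  ⟦ Γ ▷ A ⟧C = ⟦ Γ ⟧C S.· ⟦ A ⟧T

  ⟦_⟧V : ∀ {Γ A} → Var Γ A → S.Tm ⟦ Γ ⟧C ⟦ A ⟧T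
  ⟦ vz ⟧V = S.q
  ⟦ vs x ⟧V = ⟦ x ⟧V S.[ S.p ]

  mutual
    ⟦_⟧N : ∀ {Γ A} → Nf Γ A → S.Tm ⟦ Γ ⟧C ⟦ A ⟧T
    ⟦ lam u ⟧N = SA.lam ⟦ u ⟧N
    ⟦ ne x sp ⟧N = apSp ⟦ x ⟧V sp

    apSp : ∀ {Γ A C} → S.Tm ⟦ Γ ⟧C ⟦ A ⟧T → Sp Γ A C → S.Tm ⟦ Γ ⟧C ⟦ C ⟧T
    apSp h [] = h
    apSp h (m ∷ sp) = apSp (SA.ap h ⟦ m ⟧N) sp

  ⟦_⟧S : ∀ {Δ Γ} → Sub Δ Γ → S.Hom ⟦ Δ ⟧C ⟦ Γ ⟧C
  ⟦ ε ⟧S = S.!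
  ⟦ σ , a ⟧S = S.⟨ ⟦ σ ⟧S , ⟦ a ⟧N ⟩

  tuple : ∀ {D Γ} → (∀ {C} → Var Γ C → S.Tm D ⟦ C ⟧T) → S.Hom D ⟦ Γ ⟧C
  tuple {Γ = ε} f = S.!
  tuple {Γ = Γ ▷ A} f = S.⟨ tuple (λ x → f (vs x)) , f vz ⟩

  ⟦_⟧Val : ∀ {Δ C} → Val Δ C → S.Tm ⟦ Δ ⟧C ⟦ C ⟧T
  ⟦ inj₁ y ⟧Val = ⟦ y ⟧V
  ⟦ inj₂ n ⟧Val = ⟦ n ⟧N

  ⟦_⟧P : ∀ {Δ Γ} → PSub Δ Γ → S.Hom ⟦ Δ ⟧C ⟦ Γ ⟧C
  ⟦ σ ⟧P = tuple (λ x → ⟦ σ x ⟧Val)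

  ⟦_⟧R : ∀ {Δ Γ} → Ren Δ Γ → S.Hom ⟦ Δ ⟧C ⟦ Γ ⟧C
  ⟦ ρ ⟧R = tuple (λ x → ⟦ ρ x ⟧V)

  ⟦var⟧[tuple] : ∀ {D Γ C} (f : ∀ {C} → Var Γ C → S.Tm D ⟦ C ⟧T) (x : Var Γ C)
               → ⟦ x ⟧V S.[ tuple f ] ≡ f x
  ⟦var⟧[tuple] f vz = S.q[⟨⟩] _ _
  ⟦var⟧[tuple] f (vs x) = begin
    ⟦ x ⟧V S.[ S.p ] S.[ tuple f ]    ≡⟨ sym (S.[∘] _ _ _) ⟩
    ⟦ x ⟧V S.[ S.p S.∘ tuple f ]      ≡⟨ cong (⟦ x ⟧V S.[_]) (S.p∘⟨⟩ _ _) ⟩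
    ⟦ x ⟧V S.[ tuple (λ y → f (vs y)) ] ≡⟨ ⟦var⟧[tuple] (λ y → f (vs y)) x ⟩
    f (vs x)                          ∎

  tuple-cong : ∀ {D Γ} {f g : ∀ {C} → Var Γ C → S.Tm D ⟦ C ⟧T}
             → (∀ {C} (x : Var Γ C) → f x ≡ g x) → tuple f ≡ tuple g
  tuple-cong {Γ = ε} h = refl
  tuple-cong {Γ = Γ ▷ A} h = cong₂ S.⟨_,_⟩ (tuple-cong (λ x → h (vs x))) (h vz)

  tuple-∘ : ∀ {Θ D Γ} (f : ∀ {C} → Var Γ C → S.Tm D ⟦ C ⟧T) (γ : S.Hom Θ D)
          → tuple f S.∘ γ ≡ tuple (λ x → f x S.[ γ ])
  tuple-∘ {Γ = ε} f γ = S.!-unique _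
  tuple-∘ {Γ = Γ ▷ A} f γ =
    trans (⟨,⟩-∘ _ _ γ) (cong (λ z → S.⟨ z , f vz S.[ γ ] ⟩) (tuple-∘ (λ x → f (vs x)) γ))

  tuple-η : ∀ {D Γ} (γ : S.Hom D ⟦ Γ ⟧C) → tuple {Γ = Γ} (λ x → ⟦ x ⟧V S.[ γ ]) ≡ γ
  tuple-η {Γ = ε} γ = sym (S.!-unique γ)
  tuple-η {Γ = Γ ▷ A} γ =
    trans (cong (λ z → S.⟨ z , S.q S.[ γ ] ⟩)
            (trans (tuple-cong {Γ = Γ} (λ x → sym (S.[∘] ⟦ x ⟧V S.p γ))) (tuple-η {Γ = Γ} (S.p S.∘ γ))))
          (sym (S.⟨⟩-unique _ _ γ refl refl))

  tuple-id : ∀ {Γ} → tuple {Γ = Γ} (λ x → ⟦ x ⟧V) ≡ S.id {⟦ Γ ⟧C}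
  tuple-id {Γ} = trans (tuple-cong {Γ = Γ} (λ x → sym (S.[id] ⟦ x ⟧V))) (tuple-η {Γ = Γ} S.id)

  ⟦wk⟧ : ∀ {Γ B} → ⟦ wk {Γ} {B} ⟧R ≡ S.p
  ⟦wk⟧ {Γ} {B} = tuple-η {Γ = Γ} (S.p {⟦ Γ ⟧C} {⟦ B ⟧T})

  ⟦liftRen⟧ : ∀ {Δ Γ A} (ρ : Ren Δ Γ) → ⟦ liftRen {A = A} ρ ⟧R ≡ S.⟨ ⟦ ρ ⟧R S.∘ S.p , S.q ⟩
  ⟦liftRen⟧ ρ = cong (λ z → S.⟨ z , S.q ⟩) (sym (tuple-∘ (λ x → ⟦ ρ x ⟧V) S.p))

  mutual
    ⟦ren⟧ : ∀ {Δ Γ A} (ρ : Ren Δ Γ) (u : Nf Γ A) → ⟦ ren ρ u ⟧N ≡ ⟦ u ⟧N S.[ ⟦ ρ ⟧R ]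
    ⟦ren⟧ ρ (lam {A} u) =
      trans (cong SA.lam (trans (⟦ren⟧ (liftRen ρ) u) (cong (⟦ u ⟧N S.[_]) (⟦liftRen⟧ {A = A} ρ))))
            (sym (SA.lam[] ⟦ u ⟧N ⟦ ρ ⟧R))
    ⟦ren⟧ ρ (ne x sp) = trans (cong (λ z → apSp z (renSp ρ sp)) (sym (⟦var⟧[tuple] (λ y → ⟦ ρ y ⟧V) x)))
                              (apSp-renSp ρ ⟦ x ⟧V sp)

    apSp-renSp : ∀ {Δ Γ A C} (ρ : Ren Δ Γ) (h : S.Tm ⟦ Γ ⟧C ⟦ A ⟧T) (sp : Sp Γ A C)
               → apSp (h S.[ ⟦ ρ ⟧R ]) (renSp ρ sp) ≡ apSp h sp S.[ ⟦ ρ ⟧R ]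
    apSp-renSp ρ h [] = refl
    apSp-renSp ρ h (m ∷ sp) =
      trans (cong (λ z → apSp (SA.ap (h S.[ ⟦ ρ ⟧R ]) z) (renSp ρ sp)) (⟦ren⟧ ρ m))
        (trans (cong (λ z → apSp z (renSp ρ sp)) (sym (SA.ap[] h ⟦ m ⟧N ⟦ ρ ⟧R)))
          (apSp-renSp ρ (SA.ap h ⟦ m ⟧N) sp))

  ⟦ren-wk⟧ : ∀ {Γ A B} (u : Nf Γ A) → ⟦ ren (wk {B = B}) u ⟧N ≡ ⟦ u ⟧N S.[ S.p ]
  ⟦ren-wk⟧ {Γ} {A} {B} u = trans (⟦ren⟧ wk u) (cong (⟦ u ⟧N S.[_]) (⟦wk⟧ {Γ} {B}))

  ⟦renVal-wk⟧ : ∀ {Γ C B} (e : Val Γ C) → ⟦ renVal (wk {B = B}) e ⟧Val ≡ ⟦ e ⟧Val S.[ S.p ]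
  ⟦renVal-wk⟧ (inj₁ y) = refl
  ⟦renVal-wk⟧ (inj₂ n) = ⟦ren-wk⟧ n

  ⟦liftP⟧ : ∀ {Δ Γ A} (σ : PSub Δ Γ) → ⟦ liftP {B = A} σ ⟧P ≡ S.⟨ ⟦ σ ⟧P S.∘ S.p , S.q ⟩
  ⟦liftP⟧ σ = cong (λ z → S.⟨ z , S.q ⟩)
    (trans (tuple-cong (λ x → ⟦renVal-wk⟧ (σ x))) (sym (tuple-∘ (λ x → ⟦ σ x ⟧Val) S.p)))

  -- Soundness of psub and of hereditary application are proved together, by
  -- induction on types: substitution needs app only at the types of the
  -- substituted normal forms.
  AppSound : Ty → Set
  AppSound C = ∀ {Δ D} (n : Nf Δ C) (s : Sp Δ C D) → ⟦ app C n s ⟧N ≡ apSp ⟦ n ⟧N s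

  data SoundVal {Δ : Con} : ∀ {C} → Val Δ C → Set where
    var : ∀ {C} (y : Var Δ C) → SoundVal (inj₁ y)
    nf  : ∀ {C} (n : Nf Δ C) → AppSound C → SoundVal (inj₂ n)

  SoundVal-wk : ∀ {Δ C B} {e : Val Δ C} → SoundVal e → SoundVal (renVal (wk {B = B}) e)
  SoundVal-wk (var y) = var (vs y)
  SoundVal-wk (nf n ok) = nf (ren wk n) ok

  ⟦appVal⟧ : ∀ {Δ C b} {e : Val Δ C} → SoundVal e → (s : Sp Δ C (ι b))
           → ⟦ appVal e s ⟧N ≡ apSp ⟦ e ⟧Val s
  ⟦appVal⟧ (var y) s = refl
  ⟦appVal⟧ (nf n ok) s = ok n s

  mutual
    ⟦psub⟧′ : ∀ {Δ Γ A} (u : Nf Γ A) (σ : PSub Δ Γ) → (∀ {C} (x : Var Γ C) → SoundVal (σ x))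
            → ⟦ psub u σ ⟧N ≡ ⟦ u ⟧N S.[ ⟦ σ ⟧P ]
    ⟦psub⟧′ (lam u) σ h =
      trans (cong SA.lam (trans (⟦psub⟧′ u (liftP σ) (λ { vz → var vz ; (vs x) → SoundVal-wk (h x) }))
                                (cong (⟦ u ⟧N S.[_]) (⟦liftP⟧ σ))))
            (sym (SA.lam[] ⟦ u ⟧N ⟦ σ ⟧P))
    ⟦psub⟧′ (ne x sp) σ h =
      trans (⟦appVal⟧ (h x) (psubSp sp σ))
        (trans (cong (λ z → apSp z (psubSp sp σ)) (sym (⟦var⟧[tuple] (λ y → ⟦ σ y ⟧Val) x)))
          (apSp-psubSp ⟦ x ⟧V sp σ h))

    apSp-psubSp : ∀ {Δ Γ A C} (h : S.Tm ⟦ Γ ⟧C ⟦ A ⟧T) (sp : Sp Γ A C) (σ : PSub Δ Γ)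
                → (∀ {C} (x : Var Γ C) → SoundVal (σ x))
                → apSp (h S.[ ⟦ σ ⟧P ]) (psubSp sp σ) ≡ apSp h sp S.[ ⟦ σ ⟧P ]
    apSp-psubSp h [] σ g = refl
    apSp-psubSp h (m ∷ sp) σ g =
      trans (cong (λ z → apSp (SA.ap (h S.[ ⟦ σ ⟧P ]) z) (psubSp sp σ)) (⟦psub⟧′ m σ g))
        (trans (cong (λ z → apSp z (psubSp sp σ)) (sym (SA.ap[] h ⟦ m ⟧N ⟦ σ ⟧P)))
          (apSp-psubSp (SA.ap h ⟦ m ⟧N) sp σ g))

  ⟦single⟧ : ∀ {Δ A} (m : Nf Δ A) → ⟦ ⌊ single m ⌋ ⟧P ≡ S.⟨ S.id , ⟦ m ⟧N ⟩
  ⟦single⟧ {Δ} m = cong (λ z → S.⟨ z , ⟦ m ⟧N ⟩) (tuple-id {Δ})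

  ⟦app⟧ : ∀ C → AppSound C
  ⟦app⟧ C n [] = refl
  ⟦app⟧ (C₁ ⇒ C₂) (lam w) (m ∷ s) =
    trans (⟦app⟧ C₂ (hsub C₁ w (single m)) s) (cong (λ z → apSp z s) (begin
      ⟦ hsub C₁ w (single m) ⟧N
        ≡⟨ cong ⟦_⟧N (hsub≡psub C₁ w (single m)) ⟩
      ⟦ psub w ⌊ single m ⌋ ⟧N
        ≡⟨ ⟦psub⟧′ w ⌊ single m ⌋ (λ { vz → nf m (⟦app⟧ C₁) ; (vs x) → var x }) ⟩
      ⟦ w ⟧N S.[ ⟦ ⌊ single m ⌋ ⟧P ]
        ≡⟨ cong (⟦ w ⟧N S.[_]) (⟦single⟧ m) ⟩
      ⟦ w ⟧N S.[ S.⟨ S.id , ⟦ m ⟧N ⟩ ]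
        ≡⟨ sym (SA.β ⟦ w ⟧N ⟦ m ⟧N) ⟩
      SA.ap (SA.lam ⟦ w ⟧N) ⟦ m ⟧N
        ∎))

  soundVal : ∀ {Δ C} (e : Val Δ C) → SoundVal e
  soundVal (inj₁ y) = var y
  soundVal (inj₂ n) = nf n (⟦app⟧ _)

  ⟦psub⟧ : ∀ {Δ Γ A} (u : Nf Γ A) (σ : PSub Δ Γ) → ⟦ psub u σ ⟧N ≡ ⟦ u ⟧N S.[ ⟦ σ ⟧P ]
  ⟦psub⟧ u σ = ⟦psub⟧′ u σ (λ x → soundVal (σ x))

  apSp-++ : ∀ {Γ A B C} (h : S.Tm ⟦ Γ ⟧C ⟦ A ⟧T) (s : Sp Γ A B) (s' : Sp Γ B C)
          → apSp h (s ++ s') ≡ apSp (apSp h s) s'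
  apSp-++ h [] s' = refl
  apSp-++ h (m ∷ s) s' = apSp-++ (SA.ap h ⟦ m ⟧N) s s'

  ⟦eta⟧ : ∀ {Γ A} (B : Ty) (x : Var Γ A) (s : Sp Γ A B) → ⟦ eta B x s ⟧N ≡ apSp ⟦ x ⟧V s
  ⟦eta⟧ (ι b) x s = refl
  ⟦eta⟧ {Γ} (B ⇒ C) x s = trans (cong SA.lam (begin
      ⟦ eta C x′ (s′ ++ (ηvar vz ∷ [])) ⟧N
        ≡⟨ ⟦eta⟧ C x′ _ ⟩
      apSp ⟦ x′ ⟧V (s′ ++ (ηvar vz ∷ []))
        ≡⟨ apSp-++ ⟦ x′ ⟧V s′ _ ⟩
      SA.ap (apSp ⟦ x′ ⟧V s′) ⟦ ηvar (vz {Γ} {B}) ⟧N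
        ≡⟨ cong₂ SA.ap weaken-head (⟦eta⟧ B vz []) ⟩
      SA.ap (apSp ⟦ x ⟧V s S.[ S.p ]) S.q
        ∎))
    (SA.η (apSp ⟦ x ⟧V s))
    where
      x′ = vs {B = B} x
      s′ = renSp (wk {B = B}) s
      weaken-head : apSp ⟦ x′ ⟧V s′ ≡ apSp ⟦ x ⟧V s S.[ S.p ]
      weaken-head = trans (cong (λ z → apSp z s′) (sym (⟦var⟧[tuple] (λ y → ⟦ vs {B = B} y ⟧V) x)))
                          (trans (apSp-renSp wk ⟦ x ⟧V s) (cong (apSp ⟦ x ⟧V s S.[_]) (⟦wk⟧ {Γ} {B})))

  ⟦ηvar⟧ : ∀ {Γ C} (x : Var Γ C) → ⟦ ηvar x ⟧N ≡ ⟦ x ⟧V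
  ⟦ηvar⟧ {C = C} x = ⟦eta⟧ C x []

  ⟦⟪⟫⟧ : ∀ {Δ Γ} (σ : Sub Δ Γ) → ⟦ σ ⟧S ≡ ⟦ ⟪ σ ⟫ ⟧P
  ⟦⟪⟫⟧ ε = refl
  ⟦⟪⟫⟧ (σ , a) = cong (λ z → S.⟨ z , ⟦ a ⟧N ⟩) (⟦⟪⟫⟧ σ)

  ⟦tabulate⟧ : ∀ {Δ Γ} (f : ∀ {C} → Var Γ C → Nf Δ C) → ⟦ tabulate f ⟧S ≡ tuple (λ x → ⟦ f x ⟧N)
  ⟦tabulate⟧ {Γ = ε} f = refl
  ⟦tabulate⟧ {Γ = Γ ▷ A} f = cong (λ z → S.⟨ z , ⟦ f vz ⟧N ⟩) (⟦tabulate⟧ (λ x → f (vs x)))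

  ⟦[]⟧ : ∀ {Δ Γ A} (a : Nf Γ A) (γ : Sub Δ Γ) → ⟦ a [ γ ] ⟧N ≡ ⟦ a ⟧N S.[ ⟦ γ ⟧S ]
  ⟦[]⟧ a γ = trans (⟦psub⟧ a ⟪ γ ⟫) (cong (⟦ a ⟧N S.[_]) (sym (⟦⟪⟫⟧ γ)))

  ⟦idS⟧ : ∀ {Γ} → ⟦ idS {Γ} ⟧S ≡ S.id
  ⟦idS⟧ {Γ} = trans (⟦tabulate⟧ {Γ = Γ} ηvar) (trans (tuple-cong {Γ = Γ} ⟦ηvar⟧) (tuple-id {Γ}))

  ⟦∘S⟧ : ∀ {Γ Δ Θ} (γ : Sub Δ Γ) (δ : Sub Θ Δ) → ⟦ γ ∘S δ ⟧S ≡ ⟦ γ ⟧S S.∘ ⟦ δ ⟧S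
  ⟦∘S⟧ γ δ = begin
    ⟦ γ ∘S δ ⟧S                                   ≡⟨ ⟦tabulate⟧ (λ x → lookup γ x [ δ ]) ⟩
    tuple (λ x → ⟦ lookup γ x [ δ ] ⟧N)           ≡⟨ tuple-cong (λ x → ⟦[]⟧ (lookup γ x) δ) ⟩
    tuple (λ x → ⟦ lookup γ x ⟧N S.[ ⟦ δ ⟧S ])    ≡⟨ sym (tuple-∘ (λ x → ⟦ lookup γ x ⟧N) ⟦ δ ⟧S) ⟩
    ⟦ ⟪ γ ⟫ ⟧P S.∘ ⟦ δ ⟧S                         ≡⟨ cong (S._∘ ⟦ δ ⟧S) (sym (⟦⟪⟫⟧ γ)) ⟩
    ⟦ γ ⟧S S.∘ ⟦ δ ⟧S                             ∎

  ⟦pS⟧ : ∀ {Γ A} → ⟦ pS {Γ} {A} ⟧S ≡ S.p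
  ⟦pS⟧ {Γ} {A} = trans (⟦tabulate⟧ {Γ = Γ} (λ x → ηvar (vs {B = A} x)))
                       (trans (tuple-cong {Γ = Γ} (λ x → ⟦ηvar⟧ (vs {B = A} x))) (tuple-η {Γ = Γ} S.p))

module Initiality (𝓑 : Set) (X : BScwf 𝓑) where
  open NormalForms 𝓑
  open EtaExpansion 𝓑 using (ηvar)
  open TermModel 𝓑
  open Interpretation 𝓑 X

  interpret : BScwfMor TermModel X
  interpret = record
    { F₀ = ⟦_⟧C
    ; F₁ = ⟦_⟧S
    ; F-id = λ {Γ} → ⟦idS⟧ {Γ}
    ; F-∘ = ⟦∘S⟧
    ; F-⋄ = refl
    ; FTy = ⟦_⟧T
    ; FTm = ⟦_⟧N
    ; FTm-nat = ⟦[]⟧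
    ; F-· = λ Γ A → refl
    ; F-p = λ {Γ} {A} → ⟦pS⟧ {Γ} {A}
    ; F-q = λ {Γ} {A} → ⟦ηvar⟧ (vz {Γ} {A})
    ; F-⇒ = λ A B → refl
    ; F-ap = λ {Γ} {A} {B} c a → ⟦app⟧ (A ⇒ B) c (a ∷ [])
    ; F-⟦⟧ = λ b → refl
    }

  module Unique (g : BScwfMor TermModel X) where
    module G = BScwfMor g
    open ScwfProperties (BScwf.scwf X)

    G-Ty : ∀ A → G.FTy A ≡ ⟦ A ⟧T
    G-Ty (ι b) = G.F-⟦⟧ b
    G-Ty (A ⇒ B) = trans (G.F-⇒ A B) (cong₂ SA._⇒_ (G-Ty A) (G-Ty B))

    G-Ctx : ∀ Γ → G.F₀ Γ ≡ ⟦ Γ ⟧C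
    G-Ctx ε = G.F-⋄
    G-Ctx (Γ ▷ A) = trans (G.F-· Γ A) (cong₂ S._·_ (G-Ctx Γ) (G-Ty A))

    GTm : ∀ {Γ A} → Nf Γ A → S.Tm ⟦ Γ ⟧C ⟦ A ⟧T
    GTm {Γ} {A} a = subst₂ S.Tm (G-Ctx Γ) (G-Ty A) (G.FTm a)

    GHom : ∀ {Δ Γ} → Sub Δ Γ → S.Hom ⟦ Δ ⟧C ⟦ Γ ⟧C
    GHom {Δ} {Γ} γ = subst₂ S.Hom (G-Ctx Δ) (G-Ctx Γ) (G.F₁ γ)

    GTm-[] : ∀ {Δ Γ A} (a : Nf Γ A) (γ : Sub Δ Γ) → GTm (a [ γ ]) ≡ GTm a S.[ GHom γ ]
    GTm-[] {Δ} {Γ} {A} a γ = subst₂-[] (G-Ctx Δ) (G-Ctx Γ) (G-Ty A) (G.FTm a) (G.F₁ γ) (G.FTm-nat a γ)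

    GHom-∘ : ∀ {Γ Δ Θ} (γ : Sub Δ Γ) (δ : Sub Θ Δ) → GHom (γ ∘S δ) ≡ GHom γ S.∘ GHom δ
    GHom-∘ {Γ} {Δ} {Θ} γ δ = subst₂-∘ (G-Ctx Γ) (G-Ctx Δ) (G-Ctx Θ) (G.F₁ γ) (G.F₁ δ) (G.F-∘ γ δ)

    GHom-p : ∀ {Γ A} → GHom (pS {Γ} {A}) ≡ S.p
    GHom-p {Γ} {A} = subst₂-p (G.F-· Γ A) (G-Ctx Γ) (G-Ty A) (G.F₁ pS) G.F-p

    GTm-q : ∀ {Γ A} → GTm (ηvar (vz {Γ} {A})) ≡ S.q
    GTm-q {Γ} {A} = subst₂-q (G.F-· Γ A) (G-Ctx Γ) (G-Ty A) (G.FTm (ηvar vz)) G.F-q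

    GTm-apN : ∀ {Γ A B} (c : Nf Γ (A ⇒ B)) (a : Nf Γ A) → GTm (apN c a) ≡ SA.ap (GTm c) (GTm a)
    GTm-apN {Γ} {A} {B} c a =
      subst₂-ap (BScwf.arr X) (G-Ctx Γ) (G-Ty A) (G-Ty B) (G.F-⇒ A B) (G.FTm c) (G.FTm a) (G.F-ap c a)

    GTm-ηvar : ∀ {Γ C} (x : Var Γ C) → GTm (ηvar x) ≡ ⟦ x ⟧V
    GTm-ηvar vz = GTm-q
    GTm-ηvar (vs x) = trans (cong GTm (ηvar-vs x))
                            (trans (GTm-[] (ηvar x) pS) (cong₂ S._[_] (GTm-ηvar x) GHom-p))

    mutual
      GTm≡⟦⟧ : ∀ {Γ A} (u : Nf Γ A) → GTm u ≡ ⟦ u ⟧N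
      GTm≡⟦⟧ {Γ} (lam {A} u) = begin
        GTm (lam u)
          ≡⟨ sym (SA.η _) ⟩
        SA.lam (SA.ap (GTm (lam u) S.[ S.p ]) S.q)
          ≡⟨ cong₂ (λ c a → SA.lam (SA.ap c a))
               (trans (cong (GTm (lam u) S.[_]) (sym GHom-p)) (sym (GTm-[] (lam u) pS))) (sym GTm-q) ⟩
        SA.lam (SA.ap (GTm (lam u [ pS {Γ} {A} ])) (GTm (ηvar (vz {Γ} {A}))))
          ≡⟨ cong SA.lam (sym (GTm-apN _ _)) ⟩
        SA.lam (GTm (apN (lam u [ pS ]) (ηvar vz)))
          ≡⟨ cong (λ z → SA.lam (GTm z)) (apN-lam[pS] u) ⟩
        SA.lam (GTm u)
          ≡⟨ cong SA.lam (GTm≡⟦⟧ u) ⟩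
        SA.lam ⟦ u ⟧N
          ∎
      GTm≡⟦⟧ (ne x sp) = begin
        GTm (ne x sp)              ≡⟨ cong GTm (ne≡apN* x sp) ⟩
        GTm (apN* (ηvar x) sp)     ≡⟨ GTm-apN* (ηvar x) sp ⟩
        apSp (GTm (ηvar x)) sp     ≡⟨ cong (λ z → apSp z sp) (GTm-ηvar x) ⟩
        apSp ⟦ x ⟧V sp             ∎

      GTm-apN* : ∀ {Γ A C} (h : Nf Γ A) (sp : Sp Γ A C) → GTm (apN* h sp) ≡ apSp (GTm h) sp
      GTm-apN* h [] = refl
      GTm-apN* h (m ∷ sp) = trans (GTm-apN* (apN h m) sp)
        (cong (λ z → apSp z sp) (trans (GTm-apN h m) (cong (SA.ap (GTm h)) (GTm≡⟦⟧ m))))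

    GHom-, : ∀ {Δ Γ A} (γ : Sub Δ Γ) (a : Nf Δ A) → GHom (γ , a) ≡ S.⟨ GHom γ , GTm a ⟩
    GHom-, γ a = S.⟨⟩-unique _ _ _ p∘GHom q[GHom]
      where
        p∘GHom : S.p S.∘ GHom (γ , a) ≡ GHom γ
        p∘GHom = begin
          S.p S.∘ GHom (γ , a)      ≡⟨ cong (S._∘ GHom (γ , a)) (sym GHom-p) ⟩
          GHom pS S.∘ GHom (γ , a)  ≡⟨ sym (GHom-∘ pS (γ , a)) ⟩
          GHom (pS ∘S (γ , a))      ≡⟨ cong GHom (pS-∘S γ a) ⟩
          GHom γ                    ∎
        q[GHom] : S.q S.[ GHom (γ , a) ] ≡ GTm a
        q[GHom] = begin
          S.q S.[ GHom (γ , a) ]             ≡⟨ cong (S._[ GHom (γ , a) ]) (sym GTm-q) ⟩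
          GTm (ηvar vz) S.[ GHom (γ , a) ]   ≡⟨ sym (GTm-[] (ηvar vz) (γ , a)) ⟩
          GTm (ηvar vz [ γ , a ])            ≡⟨ cong GTm (ηvar[] vz (γ , a)) ⟩
          GTm a                              ∎

    GHom≡⟦⟧ : ∀ {Δ Γ} (σ : Sub Δ Γ) → GHom σ ≡ ⟦ σ ⟧S
    GHom≡⟦⟧ ε = S.!-unique _
    GHom≡⟦⟧ (σ , a) = trans (GHom-, σ a) (cong₂ S.⟨_,_⟩ (GHom≡⟦⟧ σ) (GTm≡⟦⟧ a))

    g≈interpret : g ≈ᴹ interpret
    g≈interpret = record { eq₀ = G-Ctx ; eq₁ = GHom≡⟦⟧ ; eqTy = G-Ty ; eqTm = GTm≡⟦⟧ }

proposition7 : (𝓑 : Set) → HasInitial 𝓑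
proposition7 𝓑 =
  TermModel.TermModel 𝓑 , λ X → Initiality.interpret 𝓑 X , Initiality.Unique.g≈interpret 𝓑 X
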